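{- Let $k\ge4$ and let $(i_1,\dots,i_{k-3})\in\{0,1\}^{k-3}$ have exactly one entry equal to $1$. Every graph $G\in\mathcal{G}_1(i_1,\dots,i_{k-3})$ is a $k$-$\gamma_c$-critical graph with exactly $k-3$ cut vertices.
   Context: A connected dominating set of $G$ is a set $D$ such that every vertex is in $D$ or adjacent to a vertex of $D$ and $G[D]$ is connected; $\gamma_c(G)$ is its minimum size. $G$ is $k$-$\gamma_c$-critical if $\gamma_c(G)=k$ and $\gamma_c(G+uv)<k$ for all non-adjacent $u,v$. Class $\mathcal{B}_{2,2}$: take $l\ge 2$, $m_1,\dots,m_l\ge 1$, $r\ge 0$; let $T$ be the disjoint union of stars $K_{1,m_i}$ and $r$ isolated vertices; let $S$ be the set of all star leaves. A graph in $\mathcal{B}_{2,2}$ is the complement $\overline T$ together with a new vertex $c$ (the head) adjacent exactly to the vertices of $S$. Class $\mathcal{G}_1(i_1,\dots,i_{k-3})$, where $i_l=1$ and the other entries are $0$: take vertices $c_0,\dots,c_{k-3}$ forming the path $c_0c_1\cdots c_{k-3}$ with the edge $c_{l-1}c_l$ deleted; add a complete graph $K_{n_l}$ ($n_l\ge2$) each of whose vertices is adjacent to $c_{l-1}$ and $c_l$; attach a graph $B\in\mathcal{B}_{2,2}$ whose head is $c_{k-3}$ (no other edges). -}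

module Defs where

open import Data.Nat using (ℕ; zero; suc; _≤_; _<_; _∸_)
open import Data.Fin using (Fin; toℕ)
open import Data.List using (List; length)
open import Data.List.Membership.Propositional using (_∈_)
open import Data.List.Relation.Unary.Unique.Propositional using (Unique)
open import Data.Product using (Σ; ∃; ∃-syntax; _×_; _,_)
open import Data.Sum using (_⊎_)
open import Data.Unit using (⊤)
open import Data.Empty using (⊥)
open import Data.Bool using (Bool; true; false)
open import Relation.Nullary using (¬_)
open import Relation.Binary.PropositionalEquality using (_≡_; _≢_)

-- Simple graphs: a vertex type and an (intended symmetric, irreflexive)
-- edge relation.  Finite sets of vertices are duplicate-free lists.

record Graph : Set₁ where
  field
    V : Set
    E : V → V → Set
open Graph public

addEdge : (G : Graph) → V G → V G → Graph
addEdge G u v = record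
  { V = V G
  ; E = λ x y → E G x y ⊎ ((x ≡ u × y ≡ v) ⊎ (x ≡ v × y ≡ u)) }

data Walk {A : Set} (E' : A → A → Set) (P : A → Set) : A → A → Set where
  here : ∀ {x} → P x → Walk E' P x x
  step : ∀ {x y z} → P x → E' x y → Walk E' P y z → Walk E' P x z

IsCDS : (G : Graph) → List (V G) → Set
IsCDS G D =
  Unique D
  × (∀ v → v ∈ D ⊎ (∃[ w ] (w ∈ D × E G v w)))
  × (∀ u w → u ∈ D → w ∈ D → Walk (E G) (_∈ D) u w)

module _ (G : Graph) where

  GammaCEq : ℕ → Set
  GammaCEq k =
    (∃[ D ] (IsCDS G D × length D ≡ k))
    × (∀ D → IsCDS G D → k ≤ length D)

  IsCritical : ℕ → Set
  IsCritical k =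
    GammaCEq k
    × (∀ u v → u ≢ v → ¬ E G u v →
         ∃[ D ] (IsCDS (addEdge G u v) D × length D < k))

  -- v is a cut vertex: removing v disconnects two vertices that were
  -- connected in G (i.e. removal increases the number of components)
  IsCut : V G → Set
  IsCut v = ∃[ a ] ∃[ b ]
    (a ≢ v × b ≢ v × Walk (E G) (λ _ → ⊤) a b
      × ¬ Walk (E G) (λ x → x ≢ v) a b)

  CutCount : ℕ → Set
  CutCount t = ∃[ cs ]
    (Unique cs × length cs ≡ t × (∀ v → (IsCut v → v ∈ cs) × (v ∈ cs → IsCut v)))

-- The class B_{2,2}, minus its head.  Parameters: L stars K_{1,m i},
-- r isolated vertices.

data BV (L : ℕ) (m : Fin L → ℕ) (r : ℕ) : Set where
  ctr  : Fin L → BV L m r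
  leaf : (i : Fin L) → Fin (m i) → BV L m r
  iso  : Fin r → BV L m r

TAdj : ∀ {L m r} → BV L m r → BV L m r → Set
TAdj (ctr i) (leaf i' _) = i ≡ i'
TAdj (leaf i _) (ctr i') = i ≡ i'
TAdj _ _ = ⊥

IsLeaf : ∀ {L m r} → BV L m r → Set
IsLeaf (leaf _ _) = ⊤
IsLeaf _ = ⊥

-- The graphs of G_1(i_1,...,i_{k-3}) with i_{p+1} = 1 (p : Fin (k-3)).
-- Vertices: c_0..c_{k-3} (cv, indexed by Fin (k-2)), the clique K_{nl}
-- (kv), and the non-head vertices of B (bv); the head of B is c_{k-3}.

data GV (k nl L : ℕ) (m : Fin L → ℕ) (r : ℕ) : Set where
  cv : Fin (k ∸ 2) → GV k nl L m r
  kv : Fin nl → GV k nl L m r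
  bv : BV L m r → GV k nl L m r

-- one orientation of each edge; p is the 0-based position of the 1,
-- i.e. paper's l = p + 1, deleted edge c_p c_{p+1}
GR : ∀ k nl L m r → ℕ → GV k nl L m r → GV k nl L m r → Set
GR k nl L m r p (cv i) (cv j) = (toℕ j ≡ suc (toℕ i)) × (toℕ i ≢ p)
GR k nl L m r p (kv a) (kv b) = a ≢ b
GR k nl L m r p (kv a) (cv i) = (toℕ i ≡ p) ⊎ (toℕ i ≡ suc p)
GR k nl L m r p (cv i) (bv x) = (toℕ i ≡ k ∸ 3) × IsLeaf x
GR k nl L m r p (bv x) (bv y) = x ≢ y × ¬ TAdj x y
GR k nl L m r p _ _ = ⊥

G1 : (k nl L : ℕ) (m : Fin L → ℕ) (r : ℕ) → ℕ → Graph
G1 k nl L m r p = record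
  { V = GV k nl L m r
  ; E = λ x y → GR k nl L m r p x y ⊎ GR k nl L m r p y x }

module Submission where

-- G consists of the path c₀ … c_h (h = k-3) whose
-- edge c_p c_{p+1} is replaced by a clique K, and of B ∈ B_{2,2} with head c_h.
--  * γ_c(G) = k: {a} ∪ {c₁,…,c_h} ∪ {x, partner x} (a ∈ K, x and partner x
--    leaves of different stars) is a CDS.  Conversely every c_t (t ≥ 1)
--    separates c₀ from B, so a CDS contains c₁,…,c_h, a clique vertex (to
--    cross the gap) and two vertices of B (no single one dominates B).
--  * Critical: for each non-edge uv the new edge makes one path vertex or
--    the clique vertex superfluous; every witness is a "candidate set".
--  * Cut vertices: c₁,…,c_h by the separation above; for any other v,
--    every vertex of G - v has an explicit walk to c_h.

open import Defs
open import Data.Nat using (ℕ; zero; suc; _+_; _≤_; _<_; _∸_; z≤n; s≤s; _≟_; _≤?_; s≤s⁻¹)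
open import Data.Nat.Properties
open import Data.Fin using (Fin; toℕ; fromℕ<) renaming (zero to fz; suc to fs)
import Data.Fin as F
open import Data.Fin.Properties using (toℕ-injective; toℕ<n; toℕ-fromℕ<)
open import Data.Product using (Σ; ∃; ∃-syntax; _×_; _,_; proj₁; proj₂)
open import Data.Sum using (_⊎_; inj₁; inj₂; map₂)
open import Data.Empty using (⊥; ⊥-elim)
open import Data.Unit using (⊤; tt)
open import Data.Bool using (Bool; true; false)
open import Relation.Nullary using (¬_; Dec; yes; no)
open import Relation.Nullary.Decidable using (_×-dec_; ¬?; _⊎-dec_)
open import Relation.Binary.PropositionalEquality
open import Relation.Binary.Definitions using (tri<; tri≈; tri>)
open import Data.List using (List; []; _∷_; _++_; map; filter; length; allFin; tabulate)
open import Data.List.Properties using (length-map; length-++; length-filter; filter-notAll; filter-all; length-tabulate)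
open import Data.List.Membership.Propositional using (_∈_)
open import Data.List.Membership.Propositional.Properties
open import Data.List.Relation.Unary.Any using (Any; here; there)
import Data.List.Relation.Unary.Any as Any
open import Data.List.Relation.Unary.All using (All; []; _∷_)
import Data.List.Relation.Unary.All as All
import Data.List.Relation.Unary.All.Properties as AllP
open import Data.List.Relation.Unary.Unique.Propositional using (Unique)
import Data.List.Relation.Unary.Unique.Propositional.Properties as UniqueP
open import Data.List.Relation.Unary.AllPairs using ([]; _∷_)

module _ {A : Set} where
  removeAt∈ : ∀ {x : A} (ys : List A) → x ∈ ys → List A
  removeAt∈ (y ∷ ys) (here _) = ys
  removeAt∈ (y ∷ ys) (there x∈) = y ∷ removeAt∈ ys x∈

  length-removeAt∈ : ∀ {x : A} (ys : List A) (x∈ : x ∈ ys) →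
    length ys ≡ suc (length (removeAt∈ ys x∈))
  length-removeAt∈ (y ∷ ys) (here _) = refl
  length-removeAt∈ (y ∷ ys) (there x∈) = cong suc (length-removeAt∈ ys x∈)

  ∈-removeAt∈ : ∀ {x z : A} (ys : List A) (x∈ : x ∈ ys) → z ∈ ys → z ≢ x →
    z ∈ removeAt∈ ys x∈
  ∈-removeAt∈ (y ∷ ys) (here refl) (here refl) z≢x = ⊥-elim (z≢x refl)
  ∈-removeAt∈ (y ∷ ys) (here _) (there z∈) z≢x = z∈
  ∈-removeAt∈ (y ∷ ys) (there x∈) (here e) z≢x = here e
  ∈-removeAt∈ (y ∷ ys) (there x∈) (there z∈) z≢x = there (∈-removeAt∈ ys x∈ z∈ z≢x)

  unique-⊆⇒length≤ : (xs ys : List A) → Unique xs → (∀ {z} → z ∈ xs → z ∈ ys) →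
    length xs ≤ length ys
  unique-⊆⇒length≤ [] ys _ _ = z≤n
  unique-⊆⇒length≤ (x ∷ xs) ys (x∉xs ∷ uxs) xs⊆ys =
    subst (suc (length xs) ≤_) (sym (length-removeAt∈ ys x∈ys))
      (s≤s (unique-⊆⇒length≤ xs (removeAt∈ ys x∈ys) uxs
        (λ z∈ → ∈-removeAt∈ ys x∈ys (xs⊆ys (there z∈)) (λ { refl → All.lookup x∉xs z∈ refl }))))
    where
    x∈ys = xs⊆ys (here refl)

module _ {A : Set} {E' : A → A → Set} {P : A → Set} where
  _++ʷ_ : ∀ {a b c} → Walk E' P a b → Walk E' P b c → Walk E' P a c
  here _ ++ʷ w = w
  step pa e w₁ ++ʷ w = step pa e (w₁ ++ʷ w)

  walk-start : ∀ {a b} → Walk E' P a b → P a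
  walk-start (here pa) = pa
  walk-start (step pa _ _) = pa

  reverseʷ : (∀ {x y} → E' x y → E' y x) → ∀ {a b} → Walk E' P a b → Walk E' P b a
  reverseʷ sym' (here pa) = here pa
  reverseʷ sym' (step pa e w) = reverseʷ sym' w ++ʷ step (walk-start w) (sym' e) (here pa)

  crossing-edge : (S : A → Set) → (∀ x → Dec (S x)) → ∀ {a b} → Walk E' P a b →
    S a → ¬ S b → ∃ λ x → ∃ λ y → P x × P y × E' x y × S x × ¬ S y
  crossing-edge S S? (here _) sa ¬sb = ⊥-elim (¬sb sa)
  crossing-edge S S? (step {y = y} px e w) sa ¬sb with S? y
  ... | yes sy = crossing-edge S S? w sy ¬sb
  ... | no ¬sy = _ , y , px , walk-start w , e , sa , ¬sy

  connected-via-root : (∀ {x y} → E' x y → E' y x) → (ρ : A) →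
    (∀ a → P a → Walk E' P a ρ) → ∀ a b → P a → P b → Walk E' P a b
  connected-via-root sym' ρ toRoot a b pa pb = toRoot a pa ++ʷ reverseʷ sym' (toRoot b pb)

mapʷ : ∀ {A : Set} {E₁ E₂ : A → A → Set} {P Q : A → Set} →
  (∀ {x y} → E₁ x y → E₂ x y) → (∀ {x} → P x → Q x) →
  ∀ {a b} → Walk E₁ P a b → Walk E₂ Q a b
mapʷ f g (here pa) = here (g pa)
mapʷ f g (step pa e w) = step (g pa) (f e) (mapʷ f g w)

rooted-CDS : (G : Graph) → (∀ {x y} → E G x y → E G y x) → (D : List (V G)) →
  Unique D → (∀ v → v ∈ D ⊎ ∃[ w ] (w ∈ D × E G v w)) →
  (ρ : V G) → (∀ v → v ∈ D → Walk (E G) (_∈ D) v ρ) → IsCDS G D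
rooted-CDS G sym' D uD dom ρ toRoot = uD , dom , connected-via-root sym' ρ toRoot

addEdge-comm-CDS : (G : Graph) (u v : V G) (D : List (V G)) →
  IsCDS (addEdge G u v) D → IsCDS (addEdge G v u) D
addEdge-comm-CDS G u v D (uD , dom , conn) =
  uD , (λ z → map₂ (λ { (w , w∈ , e) → w , w∈ , swap e }) (dom z)) ,
  (λ a b a∈ b∈ → mapʷ swap (λ q → q) (conn a b a∈ b∈))
  where
  swap : ∀ {x y} → E (addEdge G u v) x y → E (addEdge G v u) x y
  swap (inj₁ e) = inj₁ e
  swap (inj₂ (inj₁ e)) = inj₂ (inj₂ e)
  swap (inj₂ (inj₂ e)) = inj₂ (inj₁ e)

connected⇒¬cut : (G : Graph) (v : V G) →
  (∀ a b → a ≢ v → b ≢ v → Walk (E G) (_≢ v) a b) → ¬ IsCut G v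
connected⇒¬cut G v conn (a , b , a≢v , b≢v , _ , ¬walk) = ¬walk (conn a b a≢v b≢v)

module Core (j nl L : ℕ) (m : Fin L → ℕ) (r p : ℕ) (p≤j : p ≤ j)
  (a₀ a₁ : Fin nl) (a₀≢a₁ : a₀ ≢ a₁)
  (otherStar : Fin L → Fin L) (otherStar≢ : ∀ s → otherStar s ≢ s)
  (s₀ : Fin L) (someLeaf : ∀ i → Fin (m i)) where

  -- the path c₀ … c_h has n = j+2 vertices; its last vertex c_h is the head
  k n h : ℕ
  k = suc (suc (suc (suc j)))
  n = suc (suc j)
  h = suc j

  Vtx : Set
  Vtx = GV k nl L m r

  G : Graph
  G = G1 k nl L m r p

  Adj : Vtx → Vtx → Set
  Adj = E G

  Adj-sym : ∀ {x y} → Adj x y → Adj y x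
  Adj-sym (inj₁ e) = inj₂ e
  Adj-sym (inj₂ e) = inj₁ e

  cv-injective : ∀ {s t : Fin n} → cv {k} {nl} {L} {m} {r} s ≡ cv t → s ≡ t
  cv-injective refl = refl

  kv-injective : ∀ {a b : Fin nl} → kv {k} {nl} {L} {m} {r} a ≡ kv b → a ≡ b
  kv-injective refl = refl

  bv-injective : ∀ {x y : BV L m r} → bv {k} {nl} {L} {m} {r} x ≡ bv y → x ≡ y
  bv-injective refl = refl

  index≤h : (t : Fin n) → toℕ t ≤ h
  index≤h t = s≤s⁻¹ (toℕ<n t)

  pathIndex : (t : ℕ) → t < n → Σ (Fin n) λ u → toℕ u ≡ t
  pathIndex t t<n = fromℕ< t<n , toℕ-fromℕ< t<n

  p<h : p < h
  p<h = s≤s p≤j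

  cHead cOne cGap : Fin n
  cHead = proj₁ (pathIndex h ≤-refl)
  cOne = proj₁ (pathIndex 1 (s≤s (s≤s z≤n)))
  cGap = proj₁ (pathIndex (suc p) (s≤s p<h))

  cHead≡ : toℕ cHead ≡ h
  cHead≡ = proj₂ (pathIndex h ≤-refl)

  cOne≡ : toℕ cOne ≡ 1
  cOne≡ = proj₂ (pathIndex 1 (s≤s (s≤s z≤n)))

  cGap≡ : toℕ cGap ≡ suc p
  cGap≡ = proj₂ (pathIndex (suc p) (s≤s p<h))

  1≤cHead : 1 ≤ toℕ cHead
  1≤cHead = subst (1 ≤_) (sym cHead≡) (s≤s z≤n)

  1≤cGap : 1 ≤ toℕ cGap
  1≤cGap = subst (1 ≤_) (sym cGap≡) (s≤s z≤n)

  -- Walking along the path from c_s to c_t (s ≤ t) in any graph E' ⊇ G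
  -- through vertices satisfying Q; crossing the gap c_p c_{p+1} needs a
  -- clique vertex satisfying Q.
  pathWalkOfLength : (Q : Vtx → Set) (E' : Vtx → Vtx → Set) (emb : ∀ {x y} → Adj x y → E' x y)
    (d : ℕ) (s t : Fin n) → toℕ t ≡ d + toℕ s →
    (∀ u → toℕ s ≤ toℕ u → toℕ u ≤ toℕ t → Q (cv u)) →
    (toℕ s ≤ p → p < toℕ t → Σ (Fin nl) λ a → Q (kv a)) →
    Walk E' Q (cv s) (cv t)
  pathWalkOfLength Q E' emb zero s t t≡s onPath bridge with toℕ-injective t≡s
  ... | refl = here (onPath s ≤-refl ≤-refl)
  pathWalkOfLength Q E' emb (suc d) s t t≡d+s onPath bridge = firstStep (toℕ s ≟ p)
    where
    s<t : suc (toℕ s) ≤ toℕ t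
    s<t = subst (suc (toℕ s) ≤_) (sym t≡d+s) (s≤s (m≤n+m (toℕ s) d))
    s' : Fin n
    s' = fromℕ< (<-≤-trans (s≤s s<t) (toℕ<n t))
    s'≡ : toℕ s' ≡ suc (toℕ s)
    s'≡ = toℕ-fromℕ< (<-≤-trans (s≤s s<t) (toℕ<n t))
    qs : Q (cv s)
    qs = onPath s ≤-refl (≤-trans (n≤1+n _) s<t)
    rest : Walk E' Q (cv s') (cv t)
    rest = pathWalkOfLength Q E' emb d s' t
             (trans t≡d+s (trans (sym (+-suc d (toℕ s))) (cong (d +_) (sym s'≡))))
             (λ u s'≤u u≤t → onPath u (≤-trans (n≤1+n _) (subst (_≤ toℕ u) s'≡ s'≤u)) u≤t)
             (λ s'≤p p<t → bridge (≤-trans (n≤1+n _) (subst (_≤ p) s'≡ s'≤p)) p<t)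
    -- the first edge is c_s c_{s+1}, or the detour c_p a c_{p+1} at the gap
    firstStep : Dec (toℕ s ≡ p) → Walk E' Q (cv s) (cv t)
    firstStep (no s≢p) = step qs (emb (inj₁ (s'≡ , s≢p))) rest
    firstStep (yes s≡p) with bridge (≤-reflexive s≡p) (subst (_< toℕ t) s≡p s<t)
    ... | a , qa = step qs (emb (inj₂ (inj₁ s≡p)))
                     (step qa (emb (inj₁ (inj₂ (trans s'≡ (cong suc s≡p))))) rest)

  pathWalk : (Q : Vtx → Set) (E' : Vtx → Vtx → Set) (emb : ∀ {x y} → Adj x y → E' x y)
    (s t : Fin n) → toℕ s ≤ toℕ t →
    (∀ u → toℕ s ≤ toℕ u → toℕ u ≤ toℕ t → Q (cv u)) →
    (toℕ s ≤ p → p < toℕ t → Σ (Fin nl) λ a → Q (kv a)) →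
    Walk E' Q (cv s) (cv t)
  pathWalk Q E' emb s t s≤t = pathWalkOfLength Q E' emb (toℕ t ∸ toℕ s) s t (sym (m∸n+n≡m s≤t))

  -- Candidate sets.  candidate ks w bs consists of the clique vertices ks,
  -- the path vertices c_t with 1 ≤ t ≠ w (w = 0: all of c₁ … c_h) and the
  -- B-vertices bs.  Every CDS used below has this shape.
  Kept : ℕ → Fin n → Set
  Kept w t = 1 ≤ toℕ t × toℕ t ≢ w

  kept? : ∀ w t → Dec (Kept w t)
  kept? w t = (1 ≤? toℕ t) ×-dec ¬? (toℕ t ≟ w)

  keptPath : ℕ → List (Fin n)
  keptPath w = filter (kept? w) (allFin n)

  candidate : List (Fin nl) → ℕ → List (BV L m r) → List Vtx
  candidate ks w bs = map kv ks ++ map cv (keptPath w) ++ map bv bs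

  unique-keptPath : ∀ w → Unique (keptPath w)
  unique-keptPath w = UniqueP.filter⁺ (kept? w) (UniqueP.allFin⁺ n)

  kept-of-∈ : ∀ {w t} → t ∈ keptPath w → Kept w t
  kept-of-∈ {w} t∈ = proj₂ (∈-filter⁻ (kept? w) {xs = allFin n} t∈)

  module _ {ks : List (Fin nl)} {w : ℕ} {bs : List (BV L m r)} where
    kv∈ : ∀ {a} → a ∈ ks → kv a ∈ candidate ks w bs
    kv∈ a∈ = ∈-++⁺ˡ (∈-map⁺ kv a∈)

    cv∈ : ∀ {t} → Kept w t → cv t ∈ candidate ks w bs
    cv∈ {t} kt = ∈-++⁺ʳ (map kv ks) (∈-++⁺ˡ (∈-map⁺ cv (∈-filter⁺ (kept? w) (∈-allFin t) kt)))

    bv∈ : ∀ {x} → x ∈ bs → bv x ∈ candidate ks w bs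
    bv∈ x∈ = ∈-++⁺ʳ (map kv ks) (∈-++⁺ʳ (map cv (keptPath w)) (∈-map⁺ bv x∈))

    ∈-candidate⁻ : ∀ {v} → v ∈ candidate ks w bs →
      (∃ λ a → a ∈ ks × v ≡ kv a) ⊎ (∃ λ t → Kept w t × v ≡ cv t) ⊎ (∃ λ x → x ∈ bs × v ≡ bv x)
    ∈-candidate⁻ v∈ with ∈-++⁻ (map kv ks) v∈
    ... | inj₁ v∈K = inj₁ (∈-map⁻ kv v∈K)
    ... | inj₂ v∈CB with ∈-++⁻ (map cv (keptPath w)) v∈CB
    ... | inj₁ v∈C with ∈-map⁻ cv v∈C
    ... | t , t∈ , e = inj₂ (inj₁ (t , kept-of-∈ t∈ , e))
    ∈-candidate⁻ v∈ | inj₂ _ | inj₂ v∈B = inj₂ (inj₂ (∈-map⁻ bv v∈B))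

    unique-candidate : Unique ks → Unique bs → Unique (candidate ks w bs)
    unique-candidate uks ubs =
      UniqueP.++⁺ (UniqueP.map⁺ kv-injective uks)
        (UniqueP.++⁺ (UniqueP.map⁺ cv-injective (unique-keptPath w)) (UniqueP.map⁺ bv-injective ubs) C∩B)
        K∩CB
      where
      C∩B : ∀ {v} → ¬ (v ∈ map cv (keptPath w) × v ∈ map bv bs)
      C∩B (v∈C , v∈B) with ∈-map⁻ cv v∈C | ∈-map⁻ bv v∈B
      ... | _ , _ , refl | _ , _ , ()
      K∩CB : ∀ {v} → ¬ (v ∈ map kv ks × v ∈ (map cv (keptPath w) ++ map bv bs))
      K∩CB (v∈K , v∈CB) with ∈-map⁻ kv v∈K | ∈-++⁻ (map cv (keptPath w)) v∈CB
      ... | _ , _ , refl | inj₁ v∈C with ∈-map⁻ cv v∈C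
      ... | _ , _ , ()
      K∩CB (v∈K , v∈CB) | _ , _ , refl | inj₂ v∈B with ∈-map⁻ bv v∈B
      ... | _ , _ , ()

    length-candidate : length (candidate ks w bs) ≡ length ks + (length (keptPath w) + length bs)
    length-candidate = begin
      length (K ++ C ++ B)                  ≡⟨ length-++ K ⟩
      length K + length (C ++ B)            ≡⟨ cong (length K +_) (length-++ C) ⟩
      length K + (length C + length B)      ≡⟨ cong₂ _+_ (length-map (kv {k}) ks)
                                                (cong₂ _+_ (length-map (cv {k}) (keptPath w)) (length-map (bv {k}) bs)) ⟩
      length ks + (length (keptPath w) + length bs) ∎
      where
      open ≡-Reasoning
      K C B : List Vtx
      K = map kv ks
      C = map cv (keptPath w)
      B = map bv bs

  -- keptPath w ⊆ c₁ … c_h, with equality for w = 0 and one vertex fewer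
  -- when 1 ≤ w ≤ h.  (allFin n unfolds to fz ∷ tail, and fz is never kept.)
  pathTail : List (Fin n)
  pathTail = tabulate {n = h} fs

  length-keptPath≤ : ∀ w → length (keptPath w) ≤ h
  length-keptPath≤ w = ≤-trans (length-filter (kept? w) pathTail) (≤-reflexive (length-tabulate {n = h} fs))

  length-keptPath-0 : length (keptPath 0) ≡ h
  length-keptPath-0 = begin
    length (filter (kept? 0) pathTail)
      ≡⟨ cong length (filter-all (kept? 0) (AllP.tabulate⁺ {f = fs} (λ u → s≤s z≤n , λ ()))) ⟩
    length pathTail
      ≡⟨ length-tabulate {n = h} fs ⟩
    h ∎
    where open ≡-Reasoning

  length-keptPath-drop : ∀ w → 1 ≤ w → w ≤ h → length (keptPath w) ≤ j
  length-keptPath-drop (suc w) _ (s≤s w≤j) =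
    s≤s⁻¹ (≤-trans (filter-notAll (kept? (suc w)) pathTail dropped)
                   (≤-reflexive (length-tabulate {n = h} fs)))
    where
    dropped : Any (λ t → ¬ Kept (suc w) t) pathTail
    dropped = Any.map (λ { refl kt → proj₂ kt (cong suc (toℕ-fromℕ< (s≤s w≤j))) })
                      (∈-tabulate⁺ {f = fs} (fromℕ< (s≤s w≤j)))

  adjB : ∀ {x y} → x ≢ y → ¬ TAdj x y → Adj (bv x) (bv y)
  adjB x≢y ¬xTy = inj₁ (x≢y , ¬xTy)

  isLeaf? : ∀ (x : BV L m r) → Dec (IsLeaf x)
  isLeaf? (leaf _ _) = yes tt
  isLeaf? (ctr _) = no λ ()
  isLeaf? (iso _) = no λ ()

  _≟B_ : (x y : BV L m r) → Dec (x ≡ y)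
  ctr i ≟B ctr i' with i F.≟ i'
  ... | yes refl = yes refl
  ... | no i≢i' = no λ { refl → i≢i' refl }
  leaf i a ≟B leaf i' a' with i F.≟ i'
  ... | no i≢i' = no λ { refl → i≢i' refl }
  ... | yes refl with a F.≟ a'
  ... | yes refl = yes refl
  ... | no a≢a' = no λ { refl → a≢a' refl }
  iso i ≟B iso i' with i F.≟ i'
  ... | yes refl = yes refl
  ... | no i≢i' = no λ { refl → i≢i' refl }
  ctr _ ≟B leaf _ _ = no λ ()
  ctr _ ≟B iso _ = no λ ()
  leaf _ _ ≟B ctr _ = no λ ()
  leaf _ _ ≟B iso _ = no λ ()
  iso _ ≟B ctr _ = no λ ()
  iso _ ≟B leaf _ _ = no λ ()

  starOf : BV L m r → Fin L
  starOf (ctr i) = i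
  starOf (leaf i _) = i
  starOf (iso _) = s₀

  -- partner x: a leaf of a star other than that of x.  {x, partner x} is a
  -- connected dominating pair of B (partner-adj, partner-dominates).
  partner : BV L m r → BV L m r
  partner x = leaf (otherStar (starOf x)) (someLeaf (otherStar (starOf x)))

  partner≢ : ∀ x → x ≢ partner x
  partner≢ (leaf i a) e = otherStar≢ i (sym (cong starOf e))
  partner≢ (ctr i) ()
  partner≢ (iso i) ()

  partner-adj : ∀ x → Adj (bv x) (bv (partner x))
  partner-adj x = adjB (partner≢ x) (¬T x)
    where
    ¬T : ∀ x → ¬ TAdj x (partner x)
    ¬T (ctr i) e = otherStar≢ i (sym e)
    ¬T (leaf i a) ()
    ¬T (iso i) ()

  partner-dominates : ∀ x z →
    z ≡ x ⊎ z ≡ partner x ⊎ Adj (bv z) (bv x) ⊎ Adj (bv z) (bv (partner x))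
  partner-dominates x (iso q) = inj₂ (inj₂ (inj₂ (adjB (λ ()) (λ ()))))
  partner-dominates x (ctr s) with s F.≟ otherStar (starOf x)
  ... | no s≢ = inj₂ (inj₂ (inj₂ (adjB (λ ()) s≢)))
  ... | yes s≡ with ctr s ≟B x
  ... | yes e = inj₁ e
  ... | no ne = inj₂ (inj₂ (inj₁ (adjB ne (¬T x s≡))))
    where
    ¬T : ∀ x → s ≡ otherStar (starOf x) → ¬ TAdj (ctr s) x
    ¬T (leaf i a) s≡ e = otherStar≢ i (trans (sym s≡) e)
    ¬T (ctr i) _ ()
    ¬T (iso i) _ ()
  partner-dominates x (leaf s b) with leaf s b ≟B x
  ... | yes e = inj₁ e
  ... | no ne = byKind x ne
    where
    byKind : ∀ x → leaf s b ≢ x → leaf s b ≡ x ⊎ leaf s b ≡ partner x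
             ⊎ Adj (bv (leaf s b)) (bv x) ⊎ Adj (bv (leaf s b)) (bv (partner x))
    byKind (ctr i) ne with s F.≟ i
    ... | no s≢i = inj₂ (inj₂ (inj₁ (adjB ne s≢i)))
    ... | yes refl = inj₂ (inj₂ (inj₂ (adjB (λ e → otherStar≢ s (sym (cong starOf e))) (λ ()))))
    byKind (leaf i a) ne = inj₂ (inj₂ (inj₁ (adjB ne (λ ()))))
    byKind (iso i) ne = inj₂ (inj₂ (inj₁ (adjB ne (λ ()))))

  nonLeaves-¬TAdj : ∀ (x z : BV L m r) → ¬ IsLeaf x → ¬ IsLeaf z → ¬ TAdj z x
  nonLeaves-¬TAdj (leaf _ _) z ¬lx ¬lz = ⊥-elim (¬lx tt)
  nonLeaves-¬TAdj x (leaf _ _) ¬lx ¬lz = ⊥-elim (¬lz tt)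
  nonLeaves-¬TAdj (ctr _) (ctr _) ¬lx ¬lz ()
  nonLeaves-¬TAdj (ctr _) (iso _) ¬lx ¬lz ()
  nonLeaves-¬TAdj (iso _) (ctr _) ¬lx ¬lz ()
  nonLeaves-¬TAdj (iso _) (iso _) ¬lx ¬lz ()

  x₀ : BV L m r
  x₀ = leaf s₀ (someLeaf s₀)

  pairOf : BV L m r → List (BV L m r)
  pairOf x = x ∷ partner x ∷ []

  unique-single : ∀ {A : Set} {a : A} → Unique (a ∷ [])
  unique-single = [] ∷ []

  unique-pair : ∀ x → Unique (pairOf x)
  unique-pair x = (partner≢ x ∷ []) ∷ ([] ∷ [])

  Between : Fin n → Fin n → Fin n → Set
  Between s t u = (toℕ s ≤ toℕ u × toℕ u ≤ toℕ t) ⊎ (toℕ t ≤ toℕ u × toℕ u ≤ toℕ s)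

  GapBetween : Fin n → Fin n → Set
  GapBetween s t = (toℕ s ≤ p × p < toℕ t) ⊎ (toℕ t ≤ p × p < toℕ s)

  Avoids : ℕ → Fin n → Fin n → Set
  Avoids w s t = ∀ u → Between s t u → toℕ u ≢ w

  avoid-below : ∀ {w} (s t : Fin n) → toℕ s < w → toℕ t < w → Avoids w s t
  avoid-below s t s<w t<w u (inj₁ (_ , u≤t)) = <⇒≢ (≤-<-trans u≤t t<w)
  avoid-below s t s<w t<w u (inj₂ (_ , u≤s)) = <⇒≢ (≤-<-trans u≤s s<w)

  avoid-above : ∀ {w} (s t : Fin n) → w < toℕ s → w < toℕ t → Avoids w s t
  avoid-above s t w<s w<t u (inj₁ (s≤u , _)) = ≢-sym (<⇒≢ (<-≤-trans w<s s≤u))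
  avoid-above s t w<s w<t u (inj₂ (t≤u , _)) = ≢-sym (<⇒≢ (<-≤-trans w<t t≤u))

  -- Everything about a candidate set D = candidate ks w bs in a graph E' ⊇ G
  -- (G itself or G + uv): membership, domination and walks inside D.
  module Candidate (E' : Vtx → Vtx → Set) (emb : ∀ {x y} → Adj x y → E' x y)
     (E'-sym : ∀ {x y} → E' x y → E' y x)
     (ks : List (Fin nl)) (w : ℕ) (bs : List (BV L m r)) where
    D : List Vtx
    D = candidate ks w bs

    InD : Vtx → Set
    InD = _∈ D

    WalkD : Vtx → Vtx → Set
    WalkD = Walk E' InD

    inK : ∀ {a} → a ∈ ks → kv a ∈ D
    inK = kv∈ {ks} {w} {bs}

    inC : ∀ {t} → Kept w t → cv t ∈ D
    inC = cv∈ {ks} {w} {bs}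

    inB : ∀ {x} → x ∈ bs → bv x ∈ D
    inB = bv∈ {ks} {w} {bs}

    Dominated : Vtx → Set
    Dominated v = v ∈ D ⊎ ∃ λ u → u ∈ D × E' v u

    DominatedOut : Vtx → Set
    DominatedOut v = ∃ λ u → u ∈ D × E' v u

    isCDS : Unique ks → Unique bs → (∀ v → Dominated v) → (ρ : Vtx) →
      (∀ v → v ∈ D → WalkD v ρ) → IsCDS (record { V = Vtx ; E = E' }) D
    isCDS uks ubs dom ρ toRoot =
      rooted-CDS (record { V = Vtx ; E = E' }) E'-sym D (unique-candidate {ks} {w} {bs} uks ubs) dom ρ toRoot

    -- only c₀ and the dropped c_w are path vertices outside D
    dominating : (∀ t → toℕ t ≡ 0 → DominatedOut (cv t)) →
      (∀ t → toℕ t ≡ w → 1 ≤ w → DominatedOut (cv t)) →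
      (∀ a → Dominated (kv a)) → (∀ x → Dominated (bv x)) → ∀ v → Dominated v
    dominating dom₀ domw domK domB (cv t) with 1 ≤? toℕ t
    ... | no t≱1 = inj₂ (dom₀ t (n≤0⇒n≡0 (≮⇒≥ t≱1)))
    ... | yes 1≤t with toℕ t ≟ w
    ... | yes t≡w = inj₂ (domw t t≡w (subst (1 ≤_) t≡w 1≤t))
    ... | no t≢w = inj₁ (inC (1≤t , t≢w))
    dominating dom₀ domw domK domB (kv a) = domK a
    dominating dom₀ domw domK domB (bv x) = domB x

    reachesRoot : (ρ : Vtx) → (∀ a → a ∈ ks → WalkD (kv a) ρ) → (∀ t → Kept w t → WalkD (cv t) ρ) →
      (∀ x → x ∈ bs → WalkD (bv x) ρ) → ∀ v → v ∈ D → WalkD v ρ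
    reachesRoot ρ toK toC toB v v∈ with ∈-candidate⁻ {ks} {w} {bs} v∈
    ... | inj₁ (a , a∈ , refl) = toK a a∈
    ... | inj₂ (inj₁ (t , kt , refl)) = toC t kt
    ... | inj₂ (inj₂ (x , x∈ , refl)) = toB x x∈

    walkBetween : (s t : Fin n) → 1 ≤ toℕ s → 1 ≤ toℕ t → Avoids w s t →
      (GapBetween s t → Σ (Fin nl) λ a → InD (kv a)) → WalkD (cv s) (cv t)
    walkBetween s t 1≤s 1≤t avoids bridge with ≤-total (toℕ s) (toℕ t)
    ... | inj₁ s≤t = pathWalk InD E' emb s t s≤t
      (λ u s≤u u≤t → inC (≤-trans 1≤s s≤u , avoids u (inj₁ (s≤u , u≤t))))
      (λ s≤p p<t → bridge (inj₁ (s≤p , p<t)))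
    ... | inj₂ t≤s = reverseʷ E'-sym (pathWalk InD E' emb t s t≤s
      (λ u t≤u u≤s → inC (≤-trans 1≤t t≤u , avoids u (inj₂ (t≤u , u≤s))))
      (λ t≤p p<s → bridge (inj₂ (t≤p , p<s))))

    -- from c_t to a clique vertex a ∈ D: walk to c_p (if t ≤ p) or c_{p+1}
    -- (if t > p) and step into the clique; only the stretch walked must avoid w
    toCliqueAvoiding : ∀ a → a ∈ ks → (t : Fin n) → 1 ≤ toℕ t →
      (∀ u → (toℕ t ≤ toℕ u × toℕ u ≤ p) ⊎ (suc p ≤ toℕ u × toℕ u ≤ toℕ t) → toℕ u ≢ w) →
      WalkD (cv t) (kv a)
    toCliqueAvoiding a a∈ t 1≤t avoids with toℕ t ≤? p
    ... | yes t≤p = walkBetween t cp 1≤t 1≤cp (λ u b → avoids u (inj₁ (toP b))) (λ _ → a , inK a∈)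
                    ++ʷ step (inC (1≤cp , avoids cp (inj₁ (t≤cp , ≤-reflexive cp≡))))
                             (emb (inj₂ (inj₁ cp≡))) (here (inK a∈))
      where
      cp = proj₁ (pathIndex p (≤-trans p<h (n≤1+n _)))
      cp≡ = proj₂ (pathIndex p (≤-trans p<h (n≤1+n _)))
      t≤cp : toℕ t ≤ toℕ cp
      t≤cp = subst (toℕ t ≤_) (sym cp≡) t≤p
      1≤cp : 1 ≤ toℕ cp
      1≤cp = ≤-trans 1≤t t≤cp
      toP : ∀ {u} → Between t cp u → toℕ t ≤ toℕ u × toℕ u ≤ p
      toP (inj₁ (t≤u , u≤cp)) = t≤u , subst (toℕ _ ≤_) cp≡ u≤cp
      toP {u} (inj₂ (cp≤u , u≤t)) = ≤-trans t≤p (subst (_≤ toℕ u) cp≡ cp≤u) , ≤-trans u≤t t≤p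
    ... | no t≰p = walkBetween t cGap 1≤t 1≤cGap (λ u b → avoids u (inj₂ (toGap b))) (λ _ → a , inK a∈)
                   ++ʷ step (inC (1≤cGap , avoids cGap (inj₂ (≤-reflexive (sym cGap≡) , cGap≤t))))
                            (emb (inj₂ (inj₂ cGap≡))) (here (inK a∈))
      where
      cGap≤t : toℕ cGap ≤ toℕ t
      cGap≤t = subst (_≤ toℕ t) (sym cGap≡) (≰⇒> t≰p)
      toGap : ∀ {u} → Between t cGap u → suc p ≤ toℕ u × toℕ u ≤ toℕ t
      toGap (inj₁ (t≤u , u≤cGap)) = ≤-trans (≰⇒> t≰p) t≤u , ≤-trans u≤cGap cGap≤t
      toGap {u} (inj₂ (cGap≤u , u≤t)) = subst (_≤ toℕ u) cGap≡ cGap≤u , u≤t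

    toClique : ∀ a → a ∈ ks → (t : Fin n) → 1 ≤ toℕ t →
      (toℕ t ≤ p → w < toℕ t ⊎ p < w) → (p < toℕ t → w ≤ p ⊎ toℕ t < w) → WalkD (cv t) (kv a)
    toClique a a∈ t 1≤t below above = toCliqueAvoiding a a∈ t 1≤t avoids
      where
      avoids : ∀ u → (toℕ t ≤ toℕ u × toℕ u ≤ p) ⊎ (suc p ≤ toℕ u × toℕ u ≤ toℕ t) → toℕ u ≢ w
      avoids u (inj₁ (t≤u , u≤p)) with below (≤-trans t≤u u≤p)
      ... | inj₁ w<t = ≢-sym (<⇒≢ (<-≤-trans w<t t≤u))
      ... | inj₂ p<w = <⇒≢ (≤-<-trans u≤p p<w)
      avoids u (inj₂ (p<u , u≤t)) with above (<-≤-trans p<u u≤t)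
      ... | inj₁ w≤p = ≢-sym (<⇒≢ (≤-<-trans w≤p p<u))
      ... | inj₂ t<w = <⇒≢ (≤-<-trans u≤t t<w)

    pathToClique-w0 : ∀ a → a ∈ ks → w ≡ 0 → ∀ t → Kept w t → WalkD (cv t) (kv a)
    pathToClique-w0 a a∈ refl t kt = toClique a a∈ t (proj₁ kt) (λ _ → inj₁ (proj₁ kt)) (λ _ → inj₁ z≤n)

    pathToClique-wh : ∀ a → a ∈ ks → w ≡ h → ∀ t → Kept w t → WalkD (cv t) (kv a)
    pathToClique-wh a a∈ refl t kt =
      toClique a a∈ t (proj₁ kt) (λ _ → inj₂ p<h) (λ _ → inj₂ (≤∧≢⇒< (index≤h t) (proj₂ kt)))

    -- c₀ is dominated by a clique vertex (p = 0) or by c₁ (p ≠ 0, w ≠ 1)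
    dominate-c₀ : (p ≡ 0 → Σ (Fin nl) λ a → a ∈ ks) → (p ≢ 0 → 1 ≢ w) →
      ∀ t → toℕ t ≡ 0 → DominatedOut (cv t)
    dominate-c₀ clique c₁kept t t≡0 with p ≟ 0
    ... | yes p≡0 = kv (proj₁ (clique p≡0)) , inK (proj₂ (clique p≡0)) , emb (inj₂ (inj₁ (trans t≡0 (sym p≡0))))
    ... | no p≢0 = cv cOne , inC (subst (1 ≤_) (sym cOne≡) ≤-refl , λ e → c₁kept p≢0 (trans (sym cOne≡) e)) ,
                   emb (inj₁ (trans cOne≡ (cong suc (sym t≡0)) , λ e → p≢0 (trans (sym e) t≡0)))

    dominate-c₀-by : ∀ (s : Fin n) (v : Vtx) → toℕ s ≡ 0 → v ∈ D → E' (cv s) v →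
      ∀ t → toℕ t ≡ 0 → DominatedOut (cv t)
    dominate-c₀-by s v s≡0 v∈ e t t≡0 with toℕ-injective {i = t} {j = s} (trans t≡0 (sym s≡0))
    ... | refl = v , v∈ , e

    -- the dropped c_w (1 ≤ w ≤ h) is dominated by a clique vertex (w = p, p+1),
    -- by c_{w+1} (w < h) or by c_{h-1} (w = h)
    dominate-dropped : ∀ a → a ∈ ks → 1 ≤ w → w ≤ h → ∀ t → toℕ t ≡ w → DominatedOut (cv t)
    dominate-dropped a a∈ 1≤w w≤h t t≡w with toℕ t ≟ p
    ... | yes t≡p = kv a , inK a∈ , emb (inj₂ (inj₁ t≡p))
    ... | no t≢p with toℕ t ≟ suc p
    ... | yes t≡p+1 = kv a , inK a∈ , emb (inj₂ (inj₂ t≡p+1))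
    ... | no t≢p+1 with suc w ≤? h
    ... | yes w<h = cv c , inC (subst (1 ≤_) (sym c≡) (s≤s z≤n) , λ e → 1+n≢n (trans (sym c≡) e)) ,
                    emb (inj₁ (trans c≡ (cong suc (sym t≡w)) , t≢p))
      where
      c = proj₁ (pathIndex (suc w) (s≤s w<h))
      c≡ = proj₂ (pathIndex (suc w) (s≤s w<h))
    ... | no w≮h = cv c , inC (1≤c , λ e → 1+n≢n (sym (trans (sym c≡) (trans e w≡h)))) ,
                   emb (inj₂ (trans t≡h (cong suc (sym c≡)) ,
                              λ e → t≢p+1 (trans t≡h (cong suc (trans (sym c≡) e)))))
      where
      w≡h : w ≡ h
      w≡h = ≤-antisym w≤h (≮⇒≥ w≮h)
      t≡h : toℕ t ≡ h
      t≡h = trans t≡w w≡h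
      c = proj₁ (pathIndex j (≤-trans (n<1+n j) (n≤1+n (suc j))))
      c≡ = proj₂ (pathIndex j (≤-trans (n<1+n j) (n≤1+n (suc j))))
      1≤c : 1 ≤ toℕ c
      1≤c with j ≟ 0
      ... | yes j≡0 = ⊥-elim (t≢p+1 (trans t≡h (cong suc (trans j≡0 (sym (n≤0⇒n≡0 (subst (p ≤_) j≡0 p≤j)))))))
      ... | no j≢0 = subst (1 ≤_) (sym c≡) (n≢0⇒n>0 j≢0)

    cliqueDom-byClique : ∀ a → a ∈ ks → ∀ b → Dominated (kv b)
    cliqueDom-byClique a a∈ b with b F.≟ a
    ... | yes refl = inj₁ (inK a∈)
    ... | no b≢a = inj₂ (kv a , inK a∈ , emb (inj₁ b≢a))

    cliqueDom-byGap : w ≢ suc p → ∀ b → Dominated (kv b)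
    cliqueDom-byGap w≢p+1 b =
      inj₂ (cv cGap , inC (1≤cGap , λ e → w≢p+1 (trans (sym e) cGap≡)) , emb (inj₁ (inj₂ cGap≡)))

    bDom-byPair : ∀ x → x ∈ bs → partner x ∈ bs → ∀ z → Dominated (bv z)
    bDom-byPair x x∈ y∈ z with partner-dominates x z
    ... | inj₁ refl = inj₁ (inB x∈)
    ... | inj₂ (inj₁ refl) = inj₁ (inB y∈)
    ... | inj₂ (inj₂ (inj₁ e)) = inj₂ (bv x , inB x∈ , emb e)
    ... | inj₂ (inj₂ (inj₂ e)) = inj₂ (bv (partner x) , inB y∈ , emb e)

    headKept : h ≢ w → Kept w cHead
    headKept h≢w = 1≤cHead , λ e → h≢w (trans (sym cHead≡) e)

    leafToHead : ∀ x → x ∈ bs → IsLeaf x → h ≢ w → WalkD (bv x) (cv cHead)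
    leafToHead x x∈ lx h≢w = step (inB x∈) (emb (inj₂ (cHead≡ , lx))) (here (inC (headKept h≢w)))

    cliqueRoot : ∀ a → a ∈ ks → ∀ b → b ∈ a ∷ [] → WalkD (kv b) (kv a)
    cliqueRoot a a∈ .a (here refl) = here (inK a∈)

    -- the pair {x, partner x} reaches the head through the leaf partner x
    pairToHead : ∀ x → x ∈ bs → partner x ∈ bs → h ≢ w → ∀ y → y ∈ pairOf x → WalkD (bv y) (cv cHead)
    pairToHead x x∈ y∈ h≢w .x (here refl) = step (inB x∈) (emb (partner-adj x)) (leafToHead (partner x) y∈ tt h≢w)
    pairToHead x x∈ y∈ h≢w .(partner x) (there (here refl)) = leafToHead (partner x) y∈ tt h≢w

  length-base : ∀ a x → length (candidate (a ∷ []) 0 (pairOf x)) ≡ k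
  length-base a x = begin
    length (candidate (a ∷ []) 0 (pairOf x)) ≡⟨ length-candidate {a ∷ []} {0} {pairOf x} ⟩
    1 + (length (keptPath 0) + 2)  ≡⟨ cong (λ l → 1 + (l + 2)) length-keptPath-0 ⟩
    1 + (h + 2)                    ≡⟨ cong suc (+-comm h 2) ⟩
    k                              ∎
    where open ≡-Reasoning

  length-dropPath : ∀ a w x → 1 ≤ w → w ≤ h → length (candidate (a ∷ []) w (pairOf x)) < k
  length-dropPath a w x 1≤w w≤h = begin-strict
    length (candidate (a ∷ []) w (pairOf x)) ≡⟨ length-candidate {a ∷ []} {w} {pairOf x} ⟩
    1 + (length (keptPath w) + 2)  ≤⟨ s≤s (+-monoˡ-≤ 2 (length-keptPath-drop w 1≤w w≤h)) ⟩
    1 + (j + 2)                    ≡⟨ cong suc (+-comm j 2) ⟩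
    3 + j                          <⟨ n<1+n _ ⟩
    k                              ∎
    where open ≤-Reasoning

  length-dropClique : ∀ x → length (candidate [] 0 (pairOf x)) < k
  length-dropClique x = begin-strict
    length (candidate [] 0 (pairOf x))     ≡⟨ length-candidate {[]} {0} {pairOf x} ⟩
    length (keptPath 0) + 2        ≤⟨ +-monoˡ-≤ 2 (length-keptPath≤ 0) ⟩
    h + 2                          ≡⟨ +-comm h 2 ⟩
    2 + h                          <⟨ n<1+n _ ⟩
    k                              ∎
    where open ≤-Reasoning

  length-oneB : ∀ a z → length (candidate (a ∷ []) 0 (z ∷ [])) < k
  length-oneB a z = begin-strict
    length (candidate (a ∷ []) 0 (z ∷ [])) ≡⟨ length-candidate {a ∷ []} {0} {z ∷ []} ⟩
    1 + (length (keptPath 0) + 1)  ≤⟨ s≤s (+-monoˡ-≤ 1 (length-keptPath≤ 0)) ⟩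
    1 + (h + 1)                    ≡⟨ cong suc (+-comm h 1) ⟩
    2 + h                          <⟨ n<1+n _ ⟩
    k                              ∎
    where open ≤-Reasoning

  module Base = Candidate Adj (λ e → e) Adj-sym (a₀ ∷ []) 0 (pairOf x₀)

  base-isCDS : IsCDS G Base.D
  base-isCDS = Base.isCDS unique-single (unique-pair x₀) dom (kv a₀)
                 (Base.reachesRoot (kv a₀) (Base.cliqueRoot a₀ (here refl)) toC toB)
    where
    dom = Base.dominating (Base.dominate-c₀ (λ _ → a₀ , here refl) (λ _ ())) (λ _ _ ())
            (Base.cliqueDom-byClique a₀ (here refl)) (Base.bDom-byPair x₀ (here refl) (there (here refl)))
    toC : ∀ t → Kept 0 t → Base.WalkD (cv t) (kv a₀)
    toC = Base.pathToClique-w0 a₀ (here refl) refl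
    toB : ∀ y → y ∈ pairOf x₀ → Base.WalkD (bv y) (kv a₀)
    toB y y∈ = Base.pairToHead x₀ (here refl) (there (here refl)) (λ ()) y y∈
               ++ʷ toC cHead (Base.headKept λ ())

  -- Separation.  LeftOf t: the path before c_t, together with the clique
  -- when the gap lies before c_t.  The only way out of it is through c_t.
  LeftOf : ℕ → Vtx → Set
  LeftOf t (cv a) = toℕ a < t
  LeftOf t (kv _) = p < t
  LeftOf t (bv _) = ⊥

  leftOf? : ∀ t v → Dec (LeftOf t v)
  leftOf? t (cv a) = suc (toℕ a) ≤? t
  leftOf? t (kv _) = suc p ≤? t
  leftOf? t (bv _) = no λ ()

  leaving-LeftOf : (t : Fin n) → ∀ x y → Adj x y → LeftOf (toℕ t) x → ¬ LeftOf (toℕ t) y → y ≡ cv t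
  leaving-LeftOf t (cv a) (cv b) (inj₁ (b≡ , _)) x< ¬y< =
    cong cv (toℕ-injective (≤-antisym (subst (_≤ toℕ t) (sym b≡) x<) (≮⇒≥ ¬y<)))
  leaving-LeftOf t (cv a) (cv b) (inj₂ (a≡ , _)) x< ¬y< =
    ⊥-elim (¬y< (<-trans (subst (toℕ b <_) (sym a≡) ≤-refl) x<))
  leaving-LeftOf t (cv a) (kv b) (inj₂ (inj₁ a≡p)) x< ¬y< = ⊥-elim (¬y< (subst (_< toℕ t) a≡p x<))
  leaving-LeftOf t (cv a) (kv b) (inj₂ (inj₂ a≡p+1)) x< ¬y< =
    ⊥-elim (¬y< (<-trans (subst (p <_) (sym a≡p+1) ≤-refl) x<))
  leaving-LeftOf t (kv b) (cv a) (inj₁ (inj₁ a≡p)) x< ¬y< = ⊥-elim (¬y< (subst (_< toℕ t) (sym a≡p) x<))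
  leaving-LeftOf t (kv b) (cv a) (inj₁ (inj₂ a≡p+1)) x< ¬y< =
    cong cv (toℕ-injective (≤-antisym (subst (_≤ toℕ t) (sym a≡p+1) x<) (≮⇒≥ ¬y<)))
  leaving-LeftOf t (kv b) (kv c) _ x< ¬y< = ⊥-elim (¬y< x<)
  leaving-LeftOf t (cv a) (bv x) (inj₁ (a≡h , _)) x< ¬y< =
    ⊥-elim (<⇒≱ (<-≤-trans x< (index≤h t)) (≤-reflexive (sym a≡h)))
  leaving-LeftOf t (cv a) (bv x) (inj₂ ()) x< ¬y<
  leaving-LeftOf t (kv b) (bv x) (inj₁ ()) x< ¬y<
  leaving-LeftOf t (kv b) (bv x) (inj₂ ()) x< ¬y<

  B-neighbours-¬LeftOf : ∀ (t : Fin n) x u → Adj (bv x) u → ¬ LeftOf (toℕ t) u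
  B-neighbours-¬LeftOf t x (bv y) e ()
  B-neighbours-¬LeftOf t x (cv c) (inj₂ (c≡h , _)) c< = <⇒≱ (<-≤-trans c< (index≤h t)) (≤-reflexive (sym c≡h))
  B-neighbours-¬LeftOf t x (cv c) (inj₁ ())
  B-neighbours-¬LeftOf t x (kv c) (inj₁ ())
  B-neighbours-¬LeftOf t x (kv c) (inj₂ ())

  c₀-neighbours-LeftOf : ∀ (t : Fin n) → 1 ≤ toℕ t → ∀ u → Adj (cv fz) u → LeftOf (toℕ t) u ⊎ u ≡ cv t
  c₀-neighbours-LeftOf t 1≤t (cv c) (inj₁ (c≡1 , _)) with 2 ≤? toℕ t
  ... | yes 2≤t = inj₁ (subst (λ z → suc z ≤ toℕ t) (sym c≡1) 2≤t)
  ... | no 2≰t = inj₂ (cong cv (toℕ-injective (trans c≡1 (≤-antisym 1≤t (≮⇒≥ 2≰t)))))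
  c₀-neighbours-LeftOf t 1≤t (cv c) (inj₂ (() , _))
  c₀-neighbours-LeftOf t 1≤t (kv b) (inj₁ ())
  c₀-neighbours-LeftOf t 1≤t (kv b) (inj₂ (inj₁ 0≡p)) = inj₁ (subst (_< toℕ t) 0≡p 1≤t)
  c₀-neighbours-LeftOf t 1≤t (kv b) (inj₂ (inj₂ ()))
  c₀-neighbours-LeftOf t 1≤t (bv x) (inj₁ (() , _))
  c₀-neighbours-LeftOf t 1≤t (bv x) (inj₂ ())

  module LowerBound (D : List Vtx) (cds : IsCDS G D) where
    dom : ∀ v → v ∈ D ⊎ ∃[ w ] (w ∈ D × Adj v w)
    dom = proj₁ (proj₂ cds)

    conn : ∀ u w → u ∈ D → w ∈ D → Walk Adj (_∈ D) u w
    conn = proj₂ (proj₂ cds)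

    -- D meets LeftOf t (it dominates c₀) and its complement (it dominates
    -- B), so a walk in D leaves LeftOf t, which is possible only via c_t
    contains-path : ∀ (t : Fin n) → 1 ≤ toℕ t → cv t ∈ D
    contains-path t 1≤t = cross inside outside
      where
      inside : ∃ λ u → u ∈ D × (LeftOf (toℕ t) u ⊎ u ≡ cv t)
      inside with dom (cv fz)
      ... | inj₁ c₀∈ = cv fz , c₀∈ , inj₁ 1≤t
      ... | inj₂ (u , u∈ , e) = u , u∈ , c₀-neighbours-LeftOf t 1≤t u e
      outside : ∃ λ u → u ∈ D × ¬ LeftOf (toℕ t) u
      outside with dom (bv x₀)
      ... | inj₁ x₀∈ = bv x₀ , x₀∈ , λ ()
      ... | inj₂ (u , u∈ , e) = u , u∈ , B-neighbours-¬LeftOf t x₀ u e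
      cross : (∃ λ u → u ∈ D × (LeftOf (toℕ t) u ⊎ u ≡ cv t)) →
              (∃ λ u → u ∈ D × ¬ LeftOf (toℕ t) u) → cv t ∈ D
      cross (u , u∈ , inj₂ refl) _ = u∈
      cross (u , u∈ , inj₁ u<) (v , v∈ , ¬v<)
        with crossing-edge (LeftOf (toℕ t)) (leftOf? (toℕ t)) (conn u v u∈ v∈) u< ¬v<
      ... | x , y , _ , y∈ , e , x< , ¬y< = subst (_∈ D) (leaving-LeftOf t x y e x< ¬y<) y∈

    UpToGap : Vtx → Set
    UpToGap (cv a) = toℕ a ≤ p
    UpToGap _ = ⊥

    upToGap? : ∀ v → Dec (UpToGap v)
    upToGap? (cv a) = toℕ a ≤? p
    upToGap? (kv _) = no λ ()
    upToGap? (bv _) = no λ ()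

    leaving-UpToGap : ∀ x y → Adj x y → UpToGap x → ¬ UpToGap y → ∃ λ a → y ≡ kv a
    leaving-UpToGap (cv a) (cv b) (inj₁ (b≡ , a≢p)) a≤p ¬b≤p =
      ⊥-elim (¬b≤p (subst (_≤ p) (sym b≡) (≤∧≢⇒< a≤p a≢p)))
    leaving-UpToGap (cv a) (cv b) (inj₂ (a≡ , _)) a≤p ¬b≤p =
      ⊥-elim (¬b≤p (≤-trans (n≤1+n _) (subst (_≤ p) a≡ a≤p)))
    leaving-UpToGap (cv a) (kv b) _ _ _ = b , refl
    leaving-UpToGap (cv a) (bv x) (inj₁ (a≡h , _)) a≤p _ = ⊥-elim (<⇒≱ p<h (≤-trans (≤-reflexive (sym a≡h)) a≤p))
    leaving-UpToGap (cv a) (bv x) (inj₂ ()) _ _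

    -- D reaches c_{p+1} ∈ D from c₀ or one of its neighbours up to the gap
    contains-clique : ∃ λ a → kv a ∈ D
    contains-clique = cross start
      where
      start : (∃ λ a → kv a ∈ D) ⊎ (∃ λ u → u ∈ D × UpToGap u)
      start with dom (cv fz)
      ... | inj₁ c₀∈ = inj₂ (cv fz , c₀∈ , z≤n)
      ... | inj₂ (kv a , a∈ , _) = inj₁ (a , a∈)
      ... | inj₂ (cv c , c∈ , inj₁ (c≡1 , 0≢p)) = inj₂ (cv c , c∈ , subst (_≤ p) (sym c≡1) (n≢0⇒n>0 (≢-sym 0≢p)))
      ... | inj₂ (cv c , _ , inj₂ (() , _))
      ... | inj₂ (bv x , _ , inj₁ (() , _))
      ... | inj₂ (bv x , _ , inj₂ ())
      cross : (∃ λ a → kv a ∈ D) ⊎ (∃ λ u → u ∈ D × UpToGap u) → ∃ λ a → kv a ∈ D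
      cross (inj₁ found) = found
      cross (inj₂ (u , u∈ , u≤p))
        with crossing-edge UpToGap upToGap? (conn u (cv cGap) u∈ (contains-path cGap 1≤cGap))
                           u≤p (λ le → 1+n≰n (subst (_≤ p) cGap≡ le))
      ... | x , y , _ , y∈ , e , x≤p , ¬y≤p with leaving-UpToGap x y e x≤p ¬y≤p
      ... | a , refl = a , y∈

    OutsideB : Vtx → Set
    OutsideB (bv _) = ⊥
    OutsideB _ = ⊤

    outsideB? : ∀ v → Dec (OutsideB v)
    outsideB? (bv _) = no λ ()
    outsideB? (cv _) = yes tt
    outsideB? (kv _) = yes tt

    entering-B : ∀ x y → Adj x y → OutsideB x → ¬ OutsideB y → ∃ λ z → y ≡ bv z × IsLeaf z
    entering-B x (cv _) _ _ ¬out = ⊥-elim (¬out tt)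
    entering-B x (kv _) _ _ ¬out = ⊥-elim (¬out tt)
    entering-B (cv c) (bv z) (inj₁ (_ , lz)) _ _ = z , refl , lz
    entering-B (cv c) (bv z) (inj₂ ())
    entering-B (kv c) (bv z) (inj₁ ())
    entering-B (kv c) (bv z) (inj₂ ())

    centreDominator : ∀ i → ∃ λ z → bv z ∈ D × (∀ a → z ≢ leaf i a)
    centreDominator i with dom (bv (ctr i))
    ... | inj₁ c∈ = ctr i , c∈ , λ a ()
    ... | inj₂ (bv z , z∈ , inj₁ (_ , ¬T)) = z , z∈ , λ { a refl → ¬T refl }
    ... | inj₂ (bv z , z∈ , inj₂ (_ , ¬T)) = z , z∈ , λ { a refl → ¬T refl }
    ... | inj₂ (cv c , _ , inj₁ ())
    ... | inj₂ (cv c , _ , inj₂ (_ , ()))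
    ... | inj₂ (kv c , _ , inj₁ ())
    ... | inj₂ (kv c , _ , inj₂ ())

    -- a non-leaf of B in D is joined to the head, in D, through a leaf in D
    leafBesides : ∀ x → bv x ∈ D → ¬ IsLeaf x → ∃ λ x → ∃ λ z → bv x ∈ D × bv z ∈ D × x ≢ z
    leafBesides x x∈ ¬lx
      with crossing-edge OutsideB outsideB? (conn (cv cHead) (bv x) (contains-path cHead 1≤cHead) x∈) tt (λ ())
    ... | u , y , _ , y∈ , e , out , ¬out with entering-B u y e out ¬out
    ... | z , refl , lz = x , z , x∈ , y∈ , λ { refl → ¬lx lz }

    -- D contains two distinct B-vertices: no single vertex dominates B
    contains-two-B : ∃ λ x → ∃ λ z → bv x ∈ D × bv z ∈ D × x ≢ z
    contains-two-B with centreDominator s₀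
    ... | leaf i a , x∈ , _ with centreDominator i
    ... | z , z∈ , z≢leaf = leaf i a , z , x∈ , z∈ , λ e → z≢leaf a (sym e)
    contains-two-B | ctr i , x∈ , _ = leafBesides (ctr i) x∈ (λ ())
    contains-two-B | iso i , x∈ , _ = leafBesides (iso i) x∈ (λ ())

    -- so D ⊇ {a, x, z, c₁, …, c_h}, which has k distinct elements
    k≤|D| : k ≤ length D
    k≤|D| with contains-clique | contains-two-B
    ... | a , a∈ | x , z , x∈ , z∈ , x≢z =
      subst (_≤ length D) length-xs (unique-⊆⇒length≤ xs D unique-xs xs⊆D)
      where
      path : List Vtx
      path = map cv (keptPath 0)
      ∉path : ∀ (v : Vtx) → (∀ t → v ≢ cv t) → All (v ≢_) path
      ∉path v v≢ = All.tabulate λ y∈ → byIndex (∈-map⁻ cv y∈)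
        where
        byIndex : ∀ {y} → (∃ λ t → t ∈ keptPath 0 × y ≡ cv t) → v ≢ y
        byIndex (t , _ , refl) = v≢ t
      xs : List Vtx
      xs = kv a ∷ bv x ∷ bv z ∷ path
      unique-xs : Unique xs
      unique-xs = ((λ ()) ∷ (λ ()) ∷ ∉path (kv a) (λ t ())) ∷
                  ((λ e → x≢z (bv-injective e)) ∷ ∉path (bv x) (λ t ())) ∷
                  ∉path (bv z) (λ t ()) ∷ UniqueP.map⁺ cv-injective (unique-keptPath 0)
      xs⊆D : ∀ {y} → y ∈ xs → y ∈ D
      xs⊆D (here refl) = a∈
      xs⊆D (there (here refl)) = x∈
      xs⊆D (there (there (here refl))) = z∈
      xs⊆D (there (there (there y∈))) with ∈-map⁻ cv y∈
      ... | t , t∈ , refl = contains-path t (proj₁ (kept-of-∈ {0} t∈))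
      length-xs : length xs ≡ k
      length-xs = cong (λ l → 3 + l) (trans (length-map (cv {k}) (keptPath 0)) length-keptPath-0)

  γc≡k : GammaCEq G k
  γc≡k = (Base.D , base-isCDS , length-base a₀ x₀) , (λ D cds → LowerBound.k≤|D| D cds)

  pathToHead : (Q : Vtx → Set) (t : Fin n) → (∀ u → toℕ t ≤ toℕ u → Q (cv u)) →
    (b : Fin nl) → Q (kv b) → Walk Adj Q (cv t) (cv cHead)
  pathToHead Q t onPath b qb =
    pathWalk Q Adj (λ e → e) t cHead (subst (toℕ t ≤_) (sym cHead≡) (index≤h t))
      (λ u t≤u _ → onPath u t≤u) (λ _ _ → b , qb)

  cliqueToHead : (Q : Vtx → Set) (b b' : Fin nl) → Q (kv b) → (∀ u → 1 ≤ toℕ u → Q (cv u)) → Q (kv b') →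
    Walk Adj Q (kv b) (cv cHead)
  cliqueToHead Q b b' qb onPath qb' =
    step qb (inj₁ (inj₂ cGap≡)) (pathToHead Q cGap (λ u le → onPath u (≤-trans 1≤cGap le)) b' qb')

  module Avoiding (v : Vtx) where
    Q : Vtx → Set
    Q y = y ≢ v

    leafToHead : Q (cv cHead) → ∀ z → bv z ≢ v → IsLeaf z → Walk Adj Q (bv z) (cv cHead)
    leafToHead qh z z≢v lz = step z≢v (inj₂ (cHead≡ , lz)) (here qh)

    bToHead : (∀ z → IsLeaf z → bv z ≢ v) → (∀ z → bv z ≢ v → IsLeaf z → Walk Adj Q (bv z) (cv cHead)) →
      ∀ z → bv z ≢ v → Walk Adj Q (bv z) (cv cHead)
    bToHead leaf≢v toHead (leaf s b) z≢v = toHead (leaf s b) z≢v tt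
    bToHead leaf≢v toHead (iso q) z≢v = step z≢v (partner-adj (iso q)) (toHead (partner (iso q)) (leaf≢v _ tt) tt)
    bToHead leaf≢v toHead (ctr s) z≢v = step z≢v (partner-adj (ctr s)) (toHead (partner (ctr s)) (leaf≢v _ tt) tt)

    ¬cut : (∀ a → a ≢ v → Walk Adj Q a (cv cHead)) → ¬ IsCut G v
    ¬cut toHead = connected⇒¬cut G v (connected-via-root Adj-sym (cv cHead) toHead)

  c≢c₀ : ∀ (u : Fin n) → 1 ≤ toℕ u → cv u ≢ cv fz
  c≢c₀ u 1≤u e = <⇒≢ 1≤u (sym (cong toℕ (cv-injective e)))

  c₀-¬cut : ¬ IsCut G (cv fz)
  c₀-¬cut = Avoiding.¬cut (cv fz) toHead
    where
    toHead : ∀ a → a ≢ cv fz → Walk Adj (_≢ cv fz) a (cv cHead)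
    toHead (cv t) t≢0 = pathToHead _ t (λ u le → c≢c₀ u (≤-trans 1≤t le)) a₀ (λ ())
      where
      1≤t : 1 ≤ toℕ t
      1≤t with toℕ t ≟ 0
      ... | yes t≡0 = ⊥-elim (t≢0 (cong cv (toℕ-injective t≡0)))
      ... | no t≢0' = n≢0⇒n>0 t≢0'
    toHead (kv b) _ = cliqueToHead _ b a₀ (λ ()) c≢c₀ (λ ())
    toHead (bv z) _ = Avoiding.bToHead (cv fz) (λ _ _ ())
                        (Avoiding.leafToHead (cv fz) (c≢c₀ cHead 1≤cHead)) z (λ ())

  otherClique : Fin nl → Fin nl
  otherClique a with a F.≟ a₀
  ... | yes _ = a₁
  ... | no _ = a₀

  otherClique≢ : ∀ a → kv {k} {nl} {L} {m} {r} (otherClique a) ≢ kv a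
  otherClique≢ a e with a F.≟ a₀
  ... | yes refl = a₀≢a₁ (sym (kv-injective e))
  ... | no a≢a₀ = a≢a₀ (sym (kv-injective e))

  -- G - a (a in the clique) is connected: the other clique vertex bridges the gap
  toHead-avoiding-kv : ∀ a v → v ≢ kv a → Walk Adj (_≢ kv a) v (cv cHead)
  toHead-avoiding-kv a (cv t) _ = pathToHead _ t (λ _ _ ()) (otherClique a) (otherClique≢ a)
  toHead-avoiding-kv a (kv b) b≢a = cliqueToHead _ b (otherClique a) b≢a (λ _ _ ()) (otherClique≢ a)
  toHead-avoiding-kv a (bv z) _ =
    Avoiding.bToHead (kv a) (λ _ _ ()) (Avoiding.leafToHead (kv a) (λ ())) z (λ ())

  kv-¬cut : ∀ a → ¬ IsCut G (kv a)
  kv-¬cut a = Avoiding.¬cut (kv a) (toHead-avoiding-kv a)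

  -- removing a B-vertex x: the other B-vertices still reach the head, the
  -- centre whose partner is x via the centre of another star and a leaf
  bv-¬cut : ∀ x → ¬ IsCut G (bv x)
  bv-¬cut x = Avoiding.¬cut (bv x) toHead
    where
    toLeaf = Avoiding.leafToHead (bv x) (λ ())
    toHead : ∀ v → v ≢ bv x → Walk Adj (_≢ bv x) v (cv cHead)
    toHead (cv t) _ = pathToHead _ t (λ _ _ ()) a₀ (λ ())
    toHead (kv b) _ = cliqueToHead _ b a₀ (λ ()) (λ _ _ ()) (λ ())
    toHead (bv (leaf s b)) v≢x = toLeaf (leaf s b) v≢x tt
    toHead (bv (iso q)) v≢x =
      step v≢x (adjB (λ ()) (λ ())) (toLeaf (partner x) (λ e → partner≢ x (sym (bv-injective e))) tt)
    toHead (bv (ctr s)) v≢x with partner (ctr s) ≟B x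
    ... | no y≢x = step v≢x (partner-adj (ctr s)) (toLeaf (partner (ctr s)) (λ e → y≢x (bv-injective e)) tt)
    ... | yes refl =
      step {y = bv (ctr (otherStar s))} v≢x (adjB {ctr s} (λ e → otherStar≢ s (sym (ctr-injective e))) (λ ()))
        (step {y = bv (leaf s (someLeaf s))} (λ ()) (adjB {ctr (otherStar s)} (λ ()) (otherStar≢ s))
          (toLeaf (leaf s (someLeaf s)) (λ e → otherStar≢ s (sym (cong starOf (bv-injective e)))) tt))
      where
      ctr-injective : ∀ {a b} → ctr {L} {m} {r} a ≡ ctr b → a ≡ b
      ctr-injective refl = refl

  -- c_t (t ≥ 1) separates c₀ from B: every walk leaving LeftOf t uses c_t
  cv-cut : ∀ (t : Fin n) → 1 ≤ toℕ t → IsCut G (cv t)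
  cv-cut t 1≤t = cv fz , bv x₀ , (λ e → c≢c₀ t 1≤t (sym e)) , (λ ()) ,
    mapʷ (λ e → e) (λ _ → tt)
      (connected-via-root Adj-sym (cv cHead) (toHead-avoiding-kv a₀) (cv fz) (bv x₀) (λ ()) (λ ())) ,
    separated
    where
    separated : ¬ Walk Adj (_≢ cv t) (cv fz) (bv x₀)
    separated walk with crossing-edge (LeftOf (toℕ t)) (leftOf? (toℕ t)) walk 1≤t (λ ())
    ... | x , y , _ , y≢t , e , x< , ¬y< = y≢t (leaving-LeftOf t x y e x< ¬y<)

  cutVertices : CutCount G h
  cutVertices = map cv (keptPath 0) , UniqueP.map⁺ cv-injective (unique-keptPath 0) ,
                trans (length-map (cv {k}) (keptPath 0)) length-keptPath-0 , λ v → onlyPath v , pathCut v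
    where
    onlyPath : ∀ v → IsCut G v → v ∈ map cv (keptPath 0)
    onlyPath (cv t) cut with 1 ≤? toℕ t
    ... | yes 1≤t = ∈-map⁺ cv (∈-filter⁺ (kept? 0) (∈-allFin t) (1≤t , ≢-sym (<⇒≢ 1≤t)))
    ... | no 1≰t with toℕ-injective {i = t} {j = fz} (n≤0⇒n≡0 (≮⇒≥ 1≰t))
    ... | refl = ⊥-elim (c₀-¬cut cut)
    onlyPath (kv a) cut = ⊥-elim (kv-¬cut a cut)
    onlyPath (bv x) cut = ⊥-elim (bv-¬cut x cut)
    pathCut : ∀ v → v ∈ map cv (keptPath 0) → IsCut G v
    pathCut v v∈ with ∈-map⁻ cv v∈
    ... | t , t∈ , refl = cv-cut t (proj₁ (kept-of-∈ {0} t∈))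

  Adj+ : Vtx → Vtx → Vtx → Vtx → Set
  Adj+ u v = E (addEdge G u v)

  Adj+-sym : ∀ {u v x y} → Adj+ u v x y → Adj+ u v y x
  Adj+-sym (inj₁ e) = inj₁ (Adj-sym e)
  Adj+-sym (inj₂ (inj₁ (x≡u , y≡v))) = inj₂ (inj₂ (y≡v , x≡u))
  Adj+-sym (inj₂ (inj₂ (x≡v , y≡u))) = inj₂ (inj₁ (y≡u , x≡v))

  newEdge : ∀ {u v} → Adj+ u v u v
  newEdge = inj₂ (inj₁ (refl , refl))

  newEdge⁻ : ∀ {u v} → Adj+ u v v u
  newEdge⁻ = inj₂ (inj₂ (refl , refl))

  Smaller : Vtx → Vtx → Set
  Smaller u v = ∃ λ D → IsCDS (addEdge G u v) D × length D < k

  Smaller-sym : ∀ {u v} → Smaller u v → Smaller v u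
  Smaller-sym {u} {v} (D , cds , <k) = D , addEdge-comm-CDS G u v D cds , <k

  p≢0⇒1≢h : p ≢ 0 → 1 ≢ h
  p≢0⇒1≢h p≢0 1≡h = p≢0 (n≤0⇒n≡0 (subst (p ≤_) (suc-injective (sym 1≡h)) p≤j))

  -- new edge ctr i – leaf i b: the leaf alone dominates B
  smaller-ctr-leaf : ∀ i b → Smaller (bv (ctr i)) (bv (leaf i b))
  smaller-ctr-leaf i b =
    M.D , M.isCDS unique-single unique-single dom (kv a₀)
            (M.reachesRoot (kv a₀) (M.cliqueRoot a₀ (here refl)) toC toB) ,
    length-oneB a₀ (leaf i b)
    where
    module M = Candidate (Adj+ (bv (ctr i)) (bv (leaf i b))) inj₁ Adj+-sym (a₀ ∷ []) 0 (leaf i b ∷ [])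
    toC : ∀ t → Kept 0 t → M.WalkD (cv t) (kv a₀)
    toC = M.pathToClique-w0 a₀ (here refl) refl
    toB : ∀ y → y ∈ leaf i b ∷ [] → M.WalkD (bv y) (kv a₀)
    toB y (here refl) = M.leafToHead (leaf i b) (here refl) tt (λ ()) ++ʷ toC cHead (M.headKept λ ())
    domB : ∀ z → M.Dominated (bv z)
    domB z with z ≟B leaf i b
    ... | yes refl = inj₁ (M.inB (here refl))
    domB (ctr i') | no _ with i' F.≟ i
    ... | yes refl = inj₂ (bv (leaf i b) , M.inB (here refl) , newEdge)
    ... | no i'≢i = inj₂ (bv (leaf i b) , M.inB (here refl) , inj₁ (adjB (λ ()) i'≢i))
    domB (leaf s c) | no _ = inj₂ (cv cHead , M.inC (M.headKept λ ()) , inj₁ (inj₂ (cHead≡ , tt)))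
    domB (iso q) | no _ = inj₂ (bv (leaf i b) , M.inB (here refl) , inj₁ (adjB (λ ()) λ ()))
    dom = M.dominating (M.dominate-c₀ (λ _ → a₀ , here refl) (λ _ ())) (λ _ _ ())
            (M.cliqueDom-byClique a₀ (here refl)) domB

  -- new edge c_h – x, x not a leaf: x alone dominates B
  smaller-head-nonLeaf : (s : Fin n) → toℕ s ≡ h → ∀ x → ¬ IsLeaf x → Smaller (cv s) (bv x)
  smaller-head-nonLeaf s s≡h x ¬lx =
    M.D , M.isCDS unique-single unique-single dom (kv a₀)
            (M.reachesRoot (kv a₀) (M.cliqueRoot a₀ (here refl)) toC toB) ,
    length-oneB a₀ x
    where
    module M = Candidate (Adj+ (cv s) (bv x)) inj₁ Adj+-sym (a₀ ∷ []) 0 (x ∷ [])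
    toC : ∀ t → Kept 0 t → M.WalkD (cv t) (kv a₀)
    toC = M.pathToClique-w0 a₀ (here refl) refl
    toB : ∀ y → y ∈ x ∷ [] → M.WalkD (bv y) (kv a₀)
    toB y (here refl) = step (M.inB (here refl)) newEdge⁻
                          (toC s (subst (1 ≤_) (sym s≡h) (s≤s z≤n) , λ e → 0≢1+n (trans (sym e) s≡h)))
    domB : ∀ z → M.Dominated (bv z)
    domB z with z ≟B x
    ... | yes refl = inj₁ (M.inB (here refl))
    ... | no z≢x with isLeaf? z
    ... | yes lz = inj₂ (cv cHead , M.inC (M.headKept λ ()) , inj₁ (inj₂ (cHead≡ , lz)))
    ... | no ¬lz = inj₂ (bv x , M.inB (here refl) , inj₁ (adjB z≢x (nonLeaves-¬TAdj x z ¬lx ¬lz)))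
    dom = M.dominating (M.dominate-c₀ (λ _ → a₀ , here refl) (λ _ ())) (λ _ _ ())
            (M.cliqueDom-byClique a₀ (here refl)) domB

  -- new edge u – x with x ∈ B: drop the head c_h, which x no longer needs to
  -- reach, provided x reaches the clique vertex a in the candidate set
  module DropHead (u : Vtx) (a : Fin nl) (x : BV L m r) where
    module M = Candidate (Adj+ u (bv x)) inj₁ Adj+-sym (a ∷ []) h (pairOf x)

    smaller : M.WalkD (bv x) (kv a) → Smaller u (bv x)
    smaller route =
      M.D , M.isCDS unique-single (unique-pair x) dom (kv a)
              (M.reachesRoot (kv a) (M.cliqueRoot a (here refl)) (M.pathToClique-wh a (here refl) refl) toB) ,
      length-dropPath a h x (s≤s z≤n) ≤-refl
      where
      toB : ∀ y → y ∈ pairOf x → M.WalkD (bv y) (kv a)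
      toB y (here refl) = route
      toB y (there (here refl)) =
        step (M.inB (there (here refl))) (inj₁ (Adj-sym {bv x} {bv (partner x)} (partner-adj x))) route
      dom = M.dominating (M.dominate-c₀ (λ _ → a , here refl) p≢0⇒1≢h)
              (λ t t≡h 1≤h → M.dominate-dropped a (here refl) 1≤h ≤-refl t t≡h)
              (M.cliqueDom-byClique a (here refl)) (M.bDom-byPair x (here refl) (there (here refl)))

  smaller-clique-B : ∀ a x → Smaller (kv a) (bv x)
  smaller-clique-B a x =
    DropHead.smaller (kv a) a x (step (M.inB (here refl)) newEdge⁻ (here (M.inK (here refl))))
    where module M = DropHead.M (kv a) a x

  smaller-inner-B : (s : Fin n) → 1 ≤ toℕ s → toℕ s < h → ∀ x → Smaller (cv s) (bv x)
  smaller-inner-B s 1≤s s<h x =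
    DropHead.smaller (cv s) a₀ x
      (step (M.inB (here refl)) newEdge⁻ (M.pathToClique-wh a₀ (here refl) refl s (1≤s , <⇒≢ s<h)))
    where module M = DropHead.M (cv s) a₀ x

  -- new edge c₀ – x, p ≠ 0: x dominates c₀, so c₁ can be dropped
  smaller-c₀-B : (s : Fin n) → toℕ s ≡ 0 → p ≢ 0 → ∀ x → Smaller (cv s) (bv x)
  smaller-c₀-B s s≡0 p≢0 x =
    M.D , M.isCDS unique-single (unique-pair x) dom (kv a₀)
            (M.reachesRoot (kv a₀) (M.cliqueRoot a₀ (here refl)) toC toB) ,
    length-dropPath a₀ 1 x ≤-refl (s≤s z≤n)
    where
    module M = Candidate (Adj+ (cv s) (bv x)) inj₁ Adj+-sym (a₀ ∷ []) 1 (pairOf x)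
    h≢1 : h ≢ 1
    h≢1 e = p≢0⇒1≢h p≢0 (sym e)
    toC : ∀ t → Kept 1 t → M.WalkD (cv t) (kv a₀)
    toC t kt = M.toClique a₀ (here refl) t (proj₁ kt) (λ _ → inj₁ (≤∧≢⇒< (proj₁ kt) (≢-sym (proj₂ kt))))
                 (λ _ → inj₁ (n≢0⇒n>0 p≢0))
    toB : ∀ y → y ∈ pairOf x → M.WalkD (bv y) (kv a₀)
    toB y y∈ = M.pairToHead x (here refl) (there (here refl)) h≢1 y y∈ ++ʷ toC cHead (M.headKept h≢1)
    dom = M.dominating (M.dominate-c₀-by s (bv x) s≡0 (M.inB (here refl)) newEdge)
            (λ t t≡1 1≤1 → M.dominate-dropped a₀ (here refl) 1≤1 (s≤s z≤n) t t≡1)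
            (M.cliqueDom-byClique a₀ (here refl)) (M.bDom-byPair x (here refl) (there (here refl)))

  -- new edge c₀ – x, p = 0: x dominates c₀, and the path (through the new
  -- edge) no longer needs a clique vertex; c₁ = c_{p+1} dominates the clique
  smaller-c₀-B-gap₀ : (s : Fin n) → toℕ s ≡ 0 → p ≡ 0 → ∀ x → Smaller (cv s) (bv x)
  smaller-c₀-B-gap₀ s s≡0 p≡0 x =
    M.D , M.isCDS [] (unique-pair x) dom (cv cHead) (M.reachesRoot (cv cHead) (λ _ ()) toC toB) ,
    length-dropClique x
    where
    module M = Candidate (Adj+ (cv s) (bv x)) inj₁ Adj+-sym [] 0 (pairOf x)
    toC : ∀ t → Kept 0 t → M.WalkD (cv t) (cv cHead)
    toC t kt = M.walkBetween t cHead (proj₁ kt) 1≤cHead (avoid-above t cHead (proj₁ kt) 1≤cHead) noGap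
      where
      noGap : GapBetween t cHead → Σ (Fin nl) λ a → M.InD (kv a)
      noGap (inj₁ (t≤p , _)) = ⊥-elim (<⇒≱ (proj₁ kt) (subst (toℕ t ≤_) p≡0 t≤p))
      noGap (inj₂ (cHead≤p , _)) = ⊥-elim (<⇒≱ p<h (subst (_≤ p) cHead≡ cHead≤p))
    toB : ∀ y → y ∈ pairOf x → M.WalkD (bv y) (cv cHead)
    toB = M.pairToHead x (here refl) (there (here refl)) (λ ())
    dom = M.dominating (M.dominate-c₀-by s (bv x) s≡0 (M.inB (here refl)) newEdge) (λ _ _ ())
            (M.cliqueDom-byGap (λ ())) (M.bDom-byPair x (here refl) (there (here refl)))

  -- new edge c_s – a with s < p: the edge bypasses c_{s+1}, which is dropped
  smaller-path-clique-below : (s : Fin n) → toℕ s < p → ∀ a → Smaller (cv s) (kv a)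
  smaller-path-clique-below s s<p a =
    M.D , M.isCDS unique-single (unique-pair x₀) dom (kv a)
            (M.reachesRoot (kv a) (M.cliqueRoot a (here refl)) toC toB) ,
    length-dropPath a w x₀ (s≤s z≤n) w≤h
    where
    w = suc (toℕ s)
    w≤h : w ≤ h
    w≤h = ≤-trans s<p (≤-trans p≤j (n≤1+n j))
    h≢w : h ≢ w
    h≢w e = <⇒≱ (≤-trans s<p p≤j) (≤-reflexive (suc-injective e))
    module M = Candidate (Adj+ (cv s) (kv a)) inj₁ Adj+-sym (a ∷ []) w (pairOf x₀)
    toC : ∀ t → Kept w t → M.WalkD (cv t) (kv a)
    toC t kt with toℕ t ≤? toℕ s
    ... | yes t≤s = M.walkBetween t s (proj₁ kt) 1≤s (avoid-below t s (s≤s t≤s) ≤-refl) (λ _ → a , M.inK (here refl))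
                    ++ʷ step (M.inC (1≤s , <⇒≢ ≤-refl)) newEdge (here (M.inK (here refl)))
      where
      1≤s : 1 ≤ toℕ s
      1≤s = ≤-trans (proj₁ kt) t≤s
    ... | no t≰s = M.toClique a (here refl) t (proj₁ kt) (λ _ → inj₁ (≤∧≢⇒< (≰⇒> t≰s) (≢-sym (proj₂ kt))))
                     (λ _ → inj₁ s<p)
    toB : ∀ y → y ∈ pairOf x₀ → M.WalkD (bv y) (kv a)
    toB y y∈ = M.pairToHead x₀ (here refl) (there (here refl)) h≢w y y∈ ++ʷ toC cHead (M.headKept h≢w)
    dom₀ : ∀ t → toℕ t ≡ 0 → M.DominatedOut (cv t)
    dom₀ with toℕ s ≟ 0
    ... | yes s≡0 = M.dominate-c₀-by s (kv a) s≡0 (M.inK (here refl)) newEdge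
    ... | no s≢0 = M.dominate-c₀ (λ _ → a , here refl) (λ _ e → s≢0 (suc-injective (sym e)))
    dom = M.dominating dom₀ (λ t t≡w 1≤w → M.dominate-dropped a (here refl) 1≤w w≤h t t≡w)
            (M.cliqueDom-byClique a (here refl)) (M.bDom-byPair x₀ (here refl) (there (here refl)))

  -- new edge c_s – a with s > p+1: the edge bypasses c_{p+1}, which is dropped
  smaller-path-clique-above : (s : Fin n) → suc p < toℕ s → ∀ a → Smaller (cv s) (kv a)
  smaller-path-clique-above s p+1<s a =
    M.D , M.isCDS unique-single (unique-pair x₀) dom (kv a)
            (M.reachesRoot (kv a) (M.cliqueRoot a (here refl)) toC toB) ,
    length-dropPath a w x₀ (s≤s z≤n) p<h
    where
    w = suc p
    module M = Candidate (Adj+ (cv s) (kv a)) inj₁ Adj+-sym (a ∷ []) w (pairOf x₀)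
    1≤s : 1 ≤ toℕ s
    1≤s = ≤-trans (s≤s z≤n) p+1<s
    h≢w : h ≢ w
    h≢w e = <⇒≱ p+1<s (subst (toℕ s ≤_) e (index≤h s))
    toC : ∀ t → Kept w t → M.WalkD (cv t) (kv a)
    toC t kt with toℕ t ≤? p
    ... | yes t≤p = M.toClique a (here refl) t (proj₁ kt) (λ _ → inj₂ ≤-refl) (λ p<t → ⊥-elim (<⇒≱ p<t t≤p))
    ... | no t≰p = M.walkBetween t s (proj₁ kt) 1≤s (avoid-above t s w<t p+1<s) (λ _ → a , M.inK (here refl))
                   ++ʷ step (M.inC (1≤s , ≢-sym (<⇒≢ p+1<s))) newEdge (here (M.inK (here refl)))
      where
      w<t : w < toℕ t
      w<t = ≤∧≢⇒< (≰⇒> t≰p) (≢-sym (proj₂ kt))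
    toB : ∀ y → y ∈ pairOf x₀ → M.WalkD (bv y) (kv a)
    toB y y∈ = M.pairToHead x₀ (here refl) (there (here refl)) h≢w y y∈ ++ʷ toC cHead (M.headKept h≢w)
    dom = M.dominating (M.dominate-c₀ (λ _ → a , here refl) (λ p≢0 e → p≢0 (suc-injective (sym e))))
            (λ t t≡w 1≤w → M.dominate-dropped a (here refl) 1≤w p<h t t≡w)
            (M.cliqueDom-byClique a (here refl)) (M.bDom-byPair x₀ (here refl) (there (here refl)))

  -- c_s c_t jumps over the gap (and does not start at c₀ unless the gap does)
  AcrossGap : Fin n → Fin n → Set
  AcrossGap s t = toℕ s ≤ p × p < toℕ t × (1 ≤ toℕ s ⊎ p ≡ 0)

  acrossGap-from-p : (s t : Fin n) → toℕ s ≡ p → p < toℕ t → AcrossGap s t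
  acrossGap-from-p s t s≡p p<t with toℕ s ≟ 0
  ... | yes s≡0 = ≤-reflexive s≡p , p<t , inj₂ (trans (sym s≡p) s≡0)
  ... | no s≢0 = ≤-reflexive s≡p , p<t , inj₁ (n≢0⇒n>0 s≢0)

  -- new edge c_s – c_t across the gap: the path no longer needs the clique
  smaller-acrossGap : (s t : Fin n) → toℕ s < toℕ t → AcrossGap s t → Smaller (cv s) (cv t)
  smaller-acrossGap s t s<t (s≤p , p<t , 1≤s⊎p≡0) =
    M.D , M.isCDS [] (unique-pair x₀) dom (cv cHead) (M.reachesRoot (cv cHead) (λ _ ()) toC toB) ,
    length-dropClique x₀
    where
    module M = Candidate (Adj+ (cv s) (cv t)) inj₁ Adj+-sym [] 0 (pairOf x₀)
    1≤t : 1 ≤ toℕ t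
    1≤t = ≤-trans (s≤s z≤n) s<t
    upToHead : ∀ u → 1 ≤ toℕ u → p < toℕ u → M.WalkD (cv u) (cv cHead)
    upToHead u 1≤u p<u = M.walkBetween u cHead 1≤u 1≤cHead (avoid-above u cHead 1≤u 1≤cHead) noGap
      where
      noGap : GapBetween u cHead → Σ (Fin nl) λ a → M.InD (kv a)
      noGap (inj₁ (u≤p , _)) = ⊥-elim (<⇒≱ p<u u≤p)
      noGap (inj₂ (cHead≤p , _)) = ⊥-elim (<⇒≱ p<h (subst (_≤ p) cHead≡ cHead≤p))
    toC : ∀ u → Kept 0 u → M.WalkD (cv u) (cv cHead)
    toC u ku with toℕ u ≤? p
    ... | no u≰p = upToHead u (proj₁ ku) (≰⇒> u≰p)
    ... | yes u≤p = M.walkBetween u s (proj₁ ku) 1≤s (avoid-above u s (proj₁ ku) 1≤s) noGap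
                    ++ʷ step (M.inC (1≤s , ≢-sym (<⇒≢ 1≤s))) newEdge (upToHead t 1≤t p<t)
      where
      1≤s : 1 ≤ toℕ s
      1≤s = fromSum 1≤s⊎p≡0
        where
        -- p = 0 is impossible here, since 1 ≤ u ≤ p
        fromSum : 1 ≤ toℕ s ⊎ p ≡ 0 → 1 ≤ toℕ s
        fromSum (inj₁ 1≤s) = 1≤s
        fromSum (inj₂ p≡0) = ⊥-elim (<⇒≱ (proj₁ ku) (subst (toℕ u ≤_) p≡0 u≤p))
      noGap : GapBetween u s → Σ (Fin nl) λ a → M.InD (kv a)
      noGap (inj₁ (_ , p<s)) = ⊥-elim (<⇒≱ p<s s≤p)
      noGap (inj₂ (_ , p<u)) = ⊥-elim (<⇒≱ p<u u≤p)
    toB : ∀ y → y ∈ pairOf x₀ → M.WalkD (bv y) (cv cHead)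
    toB = M.pairToHead x₀ (here refl) (there (here refl)) (λ ())
    dom₀ : ∀ u → toℕ u ≡ 0 → M.DominatedOut (cv u)
    dom₀ with toℕ s ≟ 0
    ... | yes s≡0 = M.dominate-c₀-by s (cv t) s≡0 (M.inC (1≤t , ≢-sym (<⇒≢ 1≤t))) newEdge
    ... | no s≢0 = M.dominate-c₀ (λ p≡0 → ⊥-elim (s≢0 (n≤0⇒n≡0 (subst (toℕ s ≤_) p≡0 s≤p)))) (λ _ ())
    dom = M.dominating dom₀ (λ _ _ ()) (M.cliqueDom-byGap (λ ())) (M.bDom-byPair x₀ (here refl) (there (here refl)))

  -- any other new edge c_s – c_t (s + 1 < t): the edge bypasses c_{s+1},
  -- which is dropped.  Path vertices reach the clique vertex a₀ directly,
  -- or over the new edge when the direct route would pass c_{s+1}.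
  smaller-skip : (s t : Fin n) → suc (toℕ s) < toℕ t → ¬ AcrossGap s t → Smaller (cv s) (cv t)
  smaller-skip s t s+1<t ¬across =
    M.D , M.isCDS unique-single (unique-pair x₀) dom (kv a₀)
            (M.reachesRoot (kv a₀) (M.cliqueRoot a₀ (here refl)) toC toB) ,
    length-dropPath a₀ w x₀ (s≤s z≤n) w≤h
    where
    w = suc (toℕ s)
    w≤h : w ≤ h
    w≤h = ≤-trans (≤-trans (n≤1+n _) s+1<t) (index≤h t)
    h≢w : h ≢ w
    h≢w e = <⇒≱ s+1<t (subst (toℕ t ≤_) e (index≤h t))
    module M = Candidate (Adj+ (cv s) (cv t)) inj₁ Adj+-sym (a₀ ∷ []) w (pairOf x₀)
    a₀∈ : M.InD (kv a₀)
    a₀∈ = M.inK (here refl)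
    1≤t : 1 ≤ toℕ t
    1≤t = ≤-trans (s≤s z≤n) s+1<t
    toClique = M.toClique a₀ (here refl)
    -- u ≤ s and u ≤ p; if s < p the route from c_u up to c_p passes
    -- c_{s+1}, so go to c_s and over the new edge instead (then t ≤ p, as
    -- c_s c_t is not across the gap)
    belowBoth : ∀ u → Kept w u → toℕ u ≤ toℕ s → toℕ u ≤ p → M.WalkD (cv u) (kv a₀)
    belowBoth u ku u≤s u≤p with p ≤? toℕ s
    ... | yes p≤s = toClique u (proj₁ ku) (λ _ → inj₂ (s≤s p≤s)) (λ p<u → ⊥-elim (<⇒≱ p<u u≤p))
    ... | no p≰s = M.walkBetween u s (proj₁ ku) 1≤s (avoid-below u s (s≤s u≤s) ≤-refl) (λ _ → a₀ , a₀∈)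
                   ++ʷ step (M.inC (1≤s , <⇒≢ ≤-refl)) newEdge
                         (toClique t 1≤t (λ _ → inj₁ s+1<t) (λ p<t → ⊥-elim (<⇒≱ p<t t≤p)))
      where
      1≤s : 1 ≤ toℕ s
      1≤s = ≤-trans (proj₁ ku) u≤s
      t≤p : toℕ t ≤ p
      t≤p with suc p ≤? toℕ t
      ... | yes p<t = ⊥-elim (¬across (≤-trans (n≤1+n _) (≰⇒> p≰s) , p<t , inj₁ 1≤s))
      ... | no p≮t = s≤s⁻¹ (≰⇒> p≮t)
    -- u > s and u > p; if p ≤ s the route from c_u down to c_{p+1} passes
    -- c_{s+1}, so go to c_t and over the new edge to c_s (then p < s)
    aboveBoth : ∀ u → Kept w u → w < toℕ u → p < toℕ u → M.WalkD (cv u) (kv a₀)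
    aboveBoth u ku w<u p<u with suc (toℕ s) ≤? p
    ... | yes w≤p = toClique u (proj₁ ku) (λ u≤p → ⊥-elim (<⇒≱ p<u u≤p)) (λ _ → inj₁ w≤p)
    ... | no w≰p = M.walkBetween u t (proj₁ ku) 1≤t (avoid-above u t w<u s+1<t) (λ _ → a₀ , a₀∈)
                   ++ʷ step (M.inC (1≤t , ≢-sym (<⇒≢ s+1<t))) newEdge⁻
                         (toClique s 1≤s (λ s≤p → ⊥-elim (<⇒≱ p<s s≤p)) (λ _ → inj₂ ≤-refl))
      where
      p<s : p < toℕ s
      p<s with p ≟ toℕ s
      ... | no p≢s = ≤∧≢⇒< (s≤s⁻¹ (≰⇒> w≰p)) p≢s
      ... | yes p≡s = ⊥-elim (¬across (acrossGap-from-p s t (sym p≡s)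
                                        (subst (_< toℕ t) (sym p≡s) (≤-trans (n≤1+n _) s+1<t))))
      1≤s : 1 ≤ toℕ s
      1≤s = ≤-trans (s≤s z≤n) p<s
    toC : ∀ u → Kept w u → M.WalkD (cv u) (kv a₀)
    toC u ku with toℕ u ≤? toℕ s | toℕ u ≤? p
    ... | yes u≤s | yes u≤p = belowBoth u ku u≤s u≤p
    ... | yes u≤s | no u≰p = toClique u (proj₁ ku) (λ u≤p → ⊥-elim (u≰p u≤p)) (λ _ → inj₂ (s≤s u≤s))
    ... | no u≰s | yes u≤p = toClique u (proj₁ ku) (λ _ → inj₁ (w<u u≰s)) (λ p<u → ⊥-elim (<⇒≱ p<u u≤p))
      where
      w<u : ¬ toℕ u ≤ toℕ s → w < toℕ u
      w<u u≰s = ≤∧≢⇒< (≰⇒> u≰s) (≢-sym (proj₂ ku))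
    ... | no u≰s | no u≰p = aboveBoth u ku (≤∧≢⇒< (≰⇒> u≰s) (≢-sym (proj₂ ku))) (≰⇒> u≰p)
    toB : ∀ y → y ∈ pairOf x₀ → M.WalkD (bv y) (kv a₀)
    toB y y∈ = M.pairToHead x₀ (here refl) (there (here refl)) h≢w y y∈ ++ʷ toC cHead (M.headKept h≢w)
    dom₀ : ∀ u → toℕ u ≡ 0 → M.DominatedOut (cv u)
    dom₀ with toℕ s ≟ 0
    ... | yes s≡0 = M.dominate-c₀-by s (cv t) s≡0 (M.inC (1≤t , ≢-sym (<⇒≢ s+1<t))) newEdge
    ... | no s≢0 = M.dominate-c₀ (λ _ → a₀ , here refl) (λ _ e → s≢0 (suc-injective (sym e)))
    dom = M.dominating dom₀ (λ u u≡w 1≤w → M.dominate-dropped a₀ (here refl) 1≤w w≤h u u≡w)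
            (M.cliqueDom-byClique a₀ (here refl)) (M.bDom-byPair x₀ (here refl) (there (here refl)))

  smaller-path-path : (s t : Fin n) → toℕ s < toℕ t → ¬ (toℕ t ≡ suc (toℕ s) × toℕ s ≢ p) → Smaller (cv s) (cv t)
  smaller-path-path s t s<t ¬adj with (toℕ s ≤? p) ×-dec ((suc p ≤? toℕ t) ×-dec ((1 ≤? toℕ s) ⊎-dec (p ≟ 0)))
  ... | yes across = smaller-acrossGap s t s<t across
  ... | no ¬across = smaller-skip s t s+1<t ¬across
    where
    s+1<t : suc (toℕ s) < toℕ t
    s+1<t with toℕ t ≟ suc (toℕ s)
    ... | no t≢s+1 = ≤∧≢⇒< s<t (≢-sym t≢s+1)
    ... | yes t≡s+1 with toℕ s ≟ p
    ... | no s≢p = ⊥-elim (¬adj (t≡s+1 , s≢p))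
    ... | yes s≡p =
      ⊥-elim (¬across (acrossGap-from-p s t s≡p (subst (p <_) (sym t≡s+1) (s≤s (≤-reflexive (sym s≡p))))))

  smaller-path-clique : (s : Fin n) → ∀ a → ¬ (toℕ s ≡ p ⊎ toℕ s ≡ suc p) → Smaller (cv s) (kv a)
  smaller-path-clique s a ¬adj with <-cmp (toℕ s) p
  ... | tri< s<p _ _ = smaller-path-clique-below s s<p a
  ... | tri≈ _ s≡p _ = ⊥-elim (¬adj (inj₁ s≡p))
  ... | tri> _ _ p<s with toℕ s ≟ suc p
  ... | yes s≡p+1 = ⊥-elim (¬adj (inj₂ s≡p+1))
  ... | no s≢p+1 = smaller-path-clique-above s (≤∧≢⇒< p<s (≢-sym s≢p+1)) a

  smaller-path-B : (s : Fin n) → ∀ x → ¬ (toℕ s ≡ h × IsLeaf x) → Smaller (cv s) (bv x)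
  smaller-path-B s x ¬adj with toℕ s ≟ h
  ... | yes s≡h with isLeaf? x
  ... | yes lx = ⊥-elim (¬adj (s≡h , lx))
  ... | no ¬lx = smaller-head-nonLeaf s s≡h x ¬lx
  smaller-path-B s x ¬adj | no s≢h with toℕ s ≟ 0
  ... | no s≢0 = smaller-inner-B s (n≢0⇒n>0 s≢0) (≤∧≢⇒< (index≤h s) s≢h) x
  ... | yes s≡0 with p ≟ 0
  ... | yes p≡0 = smaller-c₀-B-gap₀ s s≡0 p≡0 x
  ... | no p≢0 = smaller-c₀-B s s≡0 p≢0 x

  smaller : ∀ u v → u ≢ v → ¬ Adj u v → Smaller u v
  smaller (cv s) (cv t) u≢v ¬adj with <-cmp (toℕ s) (toℕ t)
  ... | tri< s<t _ _ = smaller-path-path s t s<t (λ e → ¬adj (inj₁ e))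
  ... | tri≈ _ s≡t _ = ⊥-elim (u≢v (cong cv (toℕ-injective s≡t)))
  ... | tri> _ _ t<s = Smaller-sym (smaller-path-path t s t<s (λ e → ¬adj (inj₂ e)))
  smaller (cv s) (kv a) u≢v ¬adj = smaller-path-clique s a (λ e → ¬adj (inj₂ e))
  smaller (kv a) (cv s) u≢v ¬adj = Smaller-sym (smaller-path-clique s a (λ e → ¬adj (inj₁ e)))
  smaller (cv s) (bv x) u≢v ¬adj = smaller-path-B s x (λ e → ¬adj (inj₁ e))
  smaller (bv x) (cv s) u≢v ¬adj = Smaller-sym (smaller-path-B s x (λ e → ¬adj (inj₂ e)))
  smaller (kv a) (bv x) u≢v ¬adj = smaller-clique-B a x
  smaller (bv x) (kv a) u≢v ¬adj = Smaller-sym (smaller-clique-B a x)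
  smaller (kv a) (kv b) u≢v ¬adj with a F.≟ b
  ... | yes refl = ⊥-elim (u≢v refl)
  ... | no a≢b = ⊥-elim (¬adj (inj₁ a≢b))
  smaller (bv (ctr i)) (bv (leaf i' b)) u≢v ¬adj with i F.≟ i'
  ... | yes refl = smaller-ctr-leaf i b
  ... | no i≢i' = ⊥-elim (¬adj (inj₁ ((λ ()) , i≢i')))
  smaller (bv (leaf i b)) (bv (ctr i')) u≢v ¬adj with i' F.≟ i
  ... | yes refl = Smaller-sym (smaller-ctr-leaf i b)
  ... | no i'≢i = ⊥-elim (¬adj (inj₁ ((λ ()) , ≢-sym i'≢i)))
  smaller (bv (ctr i)) (bv (ctr i')) u≢v ¬adj = ⊥-elim (¬adj (inj₁ ((λ e → u≢v (cong bv e)) , λ ())))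
  smaller (bv (ctr i)) (bv (iso i')) u≢v ¬adj = ⊥-elim (¬adj (inj₁ ((λ ()) , λ ())))
  smaller (bv (leaf i b)) (bv (leaf i' b')) u≢v ¬adj = ⊥-elim (¬adj (inj₁ ((λ e → u≢v (cong bv e)) , λ ())))
  smaller (bv (leaf i b)) (bv (iso i')) u≢v ¬adj = ⊥-elim (¬adj (inj₁ ((λ ()) , λ ())))
  smaller (bv (iso i)) (bv (ctr i')) u≢v ¬adj = ⊥-elim (¬adj (inj₁ ((λ ()) , λ ())))
  smaller (bv (iso i)) (bv (leaf i' b)) u≢v ¬adj = ⊥-elim (¬adj (inj₁ ((λ ()) , λ ())))
  smaller (bv (iso i)) (bv (iso i')) u≢v ¬adj = ⊥-elim (¬adj (inj₁ ((λ e → u≢v (cong bv e)) , λ ())))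

  critical : IsCritical G k
  critical = γc≡k , smaller

-- The choices Core needs exist because nl ≥ 2, L ≥ 2 and every star has a leaf.
firstOf : ∀ {q} → 1 ≤ q → Fin q
firstOf (s≤s _) = fz

swap01 : ∀ {L'} → Fin (suc (suc L')) → Fin (suc (suc L'))
swap01 fz = fs fz
swap01 (fs _) = fz

swap01≢ : ∀ {L'} (s : Fin (suc (suc L'))) → swap01 s ≢ s
swap01≢ fz ()
swap01≢ (fs _) ()

lemma13 : (k : ℕ) → 4 ≤ k →
    (is : Fin (k ∸ 3) → Bool) (p : Fin (k ∸ 3)) →
    is p ≡ true → (∀ q → q ≢ p → is q ≡ false) →
    (nl : ℕ) → 2 ≤ nl →
    (L : ℕ) → 2 ≤ L → (m : Fin L → ℕ) → (∀ i → 1 ≤ m i) → (r : ℕ) →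
    IsCritical (G1 k nl L m r (toℕ p)) k
    × CutCount (G1 k nl L m r (toℕ p)) (k ∸ 3)
lemma13 (suc (suc (suc (suc j)))) (s≤s (s≤s (s≤s (s≤s _)))) _ p _ _
        (suc (suc nl')) (s≤s (s≤s _)) (suc (suc L')) (s≤s (s≤s _)) m m≥1 r =
  G.critical , G.cutVertices
  where
  module G = Core j (suc (suc nl')) (suc (suc L')) m r (toℕ p) (s≤s⁻¹ (toℕ<n p))
               fz (fs fz) (λ ()) swap01 swap01≢ fz (λ i → firstOf (m≥1 i))
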